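{- Let $T$ be a tree with $n$ vertices and let $e_a,e_b$ be distinct edges of $T$ with $\theta_T(e_a)=(n-i,i)$ and $\theta_T(e_b)=(n-k,k)$, where $i\ge k$. Then $\theta_T(\{e_a,e_b\})=\mathrm{re}(n-i,i-k,k)$ if and only if $e_a$ and $e_b$ attract.
   Context: For a finite tree $T$ and a set $S\subseteq E(T)$, $\theta_T(S)$ is the partition of $\#V(T)$ whose parts are the numbers of vertices of the connected components of the graph $(V(T),E(T)\setminus S)$; for a single edge $e$ write $\theta_T(e)=\theta_T(\{e\})$. Partitions are written with parts in weakly decreasing order. For nonnegative integers $a_1,\dots,a_r$, $\mathrm{re}(a_1,\dots,a_r)$ denotes the partition whose parts are the positive entries among $a_1,\dots,a_r$, sorted into weakly decreasing order. The weight of a vertex $v$ of $T$ is the maximal number of edges in any subtree of $T$ containing $v$ as a leaf; the centroids of $T$ are the vertices of minimum weight. Two distinct edges $e_a,e_b$ of $T$ attract if there is a path in $T$ containing both $e_a$ and $e_b$ and having a centroid of $T$ as one endpoint; otherwise they repel. -}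

module Defs where

open import Data.Nat using (ℕ; zero; suc; _≤_; _≤ᵇ_; _<ᵇ_)
open import Data.Bool using (Bool; true; false; if_then_else_; _∨_; _∧_; not)
open import Data.Fin using (Fin; toℕ; _≟_)
open import Data.Fin.Subset using (Subset; ⁅_⁆; ∣_∣; _∈_; inside)
open import Data.List using (List; []; _∷_; _∷ʳ_; length; map; foldr; filterᵇ; allFin)
open import Data.Bool.ListAction using (any)
open import Data.List.Membership.Propositional renaming (_∈_ to _∈L_)
open import Data.List.Relation.Unary.Linked using (Linked)
open import Data.List.Relation.Unary.Unique.Propositional using (Unique)
open import Data.Vec using (Vec; lookup; _[_]≔_)
open import Data.Product using (Σ; ∃; ∃-syntax; _×_; _,_; proj₁; proj₂)
open import Data.Sum using (_⊎_)
open import Relation.Nullary using (¬_; does)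
open import Relation.Binary.PropositionalEquality using (_≡_; _≢_)

-- Graphs on the vertex set Fin n, given by a vector of m edges.
-- Sets of edges are subsets S : Subset m of the edge indices.

Edges : ℕ → ℕ → Set
Edges n m = Vec (Fin n × Fin n) m

keep : ∀ {n m} → Edges n m → Subset m → List (Fin n × Fin n)
keep {m = m} E F = map (lookup E) (filterᵇ (lookup F) (allFin m))

Adj : ∀ {n} → List (Fin n × Fin n) → Fin n → Fin n → Set
Adj L u v = ((u , v) ∈L L) ⊎ ((v , u) ∈L L)

data Walk {n} (L : List (Fin n × Fin n)) : Fin n → Fin n → Set where
  here : ∀ {u} → Walk L u u
  step : ∀ {u w v} → Adj L u w → Walk L w v → Walk L u v

Cycle : ∀ {n} → List (Fin n × Fin n) → Fin n → List (Fin n) → Set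
Cycle L u xs = (2 ≤ length xs) × Unique (u ∷ xs) × Linked (Adj L) ((u ∷ xs) ∷ʳ u)

SameEdge : ∀ {n} → Fin n × Fin n → Fin n × Fin n → Set
SameEdge (a , b) (c , d) = ((a ≡ c) × (b ≡ d)) ⊎ ((a ≡ d) × (b ≡ c))

record IsTree {n m} (E : Edges n m) : Set where
  field
    noLoop    : ∀ j → proj₁ (lookup E j) ≢ proj₂ (lookup E j)
    noMulti   : ∀ j j′ → j ≢ j′ → ¬ SameEdge (lookup E j) (lookup E j′)
    connected : ∀ u v → Walk (keep E (Data.Vec.replicate m inside)) u v
    acyclic   : ∀ u xs → ¬ Cycle (keep E (Data.Vec.replicate m inside)) u xs

allEdges : ∀ {n m} → Edges n m → List (Fin n × Fin n)
allEdges {m = m} E = keep E (Data.Vec.replicate m inside)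

addEdge : ∀ {n} → Fin n × Fin n → Subset n → Subset n
addEdge (x , y) R =
  if lookup R x ∨ lookup R y then ((R [ x ]≔ inside) [ y ]≔ inside) else R

pass : ∀ {n} → List (Fin n × Fin n) → Subset n → Subset n
pass L R = foldr addEdge R L

iter : ∀ {A : Set} → ℕ → (A → A) → A → A
iter zero    f a = a
iter (suc k) f a = f (iter k f a)

-- vertex set of the connected component of v in the graph (Fin n, L):
-- n relaxation passes suffice, since every vertex of the component is at
-- distance < n from v.
comp : ∀ {n} → List (Fin n × Fin n) → Fin n → Subset n
comp {n} L v = iter n (pass L) ⁅ v ⁆

isRep : ∀ {n} → List (Fin n × Fin n) → Fin n → Bool
isRep {n} L v = not (any (λ w → (toℕ w <ᵇ toℕ v) ∧ lookup (comp L v) w) (allFin n))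

compSizes : ∀ {n} → List (Fin n × Fin n) → List ℕ
compSizes {n} L = map (λ v → ∣ comp L v ∣) (filterᵇ (isRep L) (allFin n))

insertDesc : ℕ → List ℕ → List ℕ
insertDesc x []       = x ∷ []
insertDesc x (y ∷ ys) = if y ≤ᵇ x then x ∷ y ∷ ys else y ∷ insertDesc x ys

sortDesc : List ℕ → List ℕ
sortDesc = foldr insertDesc []

θ : ∀ {n m} → Edges n m → Subset m → List ℕ
θ E S = sortDesc (compSizes (keep E (Data.Fin.Subset.∁ S)))

re : List ℕ → List ℕ
re as = sortDesc (filterᵇ (λ a → 0 <ᵇ a) as)

endpoint : ∀ {n} → Fin n → Fin n × Fin n → Bool
endpoint v (a , b) = does (v ≟ a) ∨ does (v ≟ b)

degIn : ∀ {n m} → Edges n m → Subset m → Fin n → ℕ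
degIn {m = m} E F v =
  length (filterᵇ (λ j → lookup F j ∧ endpoint v (lookup E j)) (allFin m))

InSpan : ∀ {n m} → Edges n m → Subset m → Fin n → Set
InSpan E F x = ∃[ j ] (j ∈ F × ((x ≡ proj₁ (lookup E j)) ⊎ (x ≡ proj₂ (lookup E j))))

-- F is the edge set of a subtree of T having v as a leaf:
-- the subgraph spanned by F is connected (it is acyclic as a subgraph of
-- a tree) and v has degree 1 in it.
LeafSubtree : ∀ {n m} → Edges n m → Fin n → Subset m → Set
LeafSubtree E v F =
  (degIn E F v ≡ 1) × (∀ x y → InSpan E F x → InSpan E F y → Walk (keep E F) x y)

IsWeight : ∀ {n m} → Edges n m → Fin n → ℕ → Set
IsWeight E v w =
  (∃[ F ] (LeafSubtree E v F × ∣ F ∣ ≡ w)) × (∀ F → LeafSubtree E v F → ∣ F ∣ ≤ w)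

Centroid : ∀ {n m} → Edges n m → Fin n → Set
Centroid E c = ∃[ w ] (IsWeight E c w × (∀ v w′ → IsWeight E v w′ → w ≤ w′))

IsPath : ∀ {n} → List (Fin n × Fin n) → List (Fin n) → Set
IsPath L p = Unique p × Linked (Adj L) p

data Consec {n} (u v : Fin n) : List (Fin n) → Set where
  now   : ∀ {xs} → Consec u v (u ∷ v ∷ xs)
  later : ∀ {x xs} → Consec u v xs → Consec u v (x ∷ xs)

OnPath : ∀ {n} → Fin n × Fin n → List (Fin n) → Set
OnPath (a , b) p = Consec a b p ⊎ Consec b a p

HasEndpoint : ∀ {n} → Fin n → List (Fin n) → Set
HasEndpoint c p = (∃[ xs ] (p ≡ c ∷ xs)) ⊎ (∃[ xs ] (p ≡ xs ∷ʳ c))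

Attract : ∀ {n m} → Edges n m → Fin m → Fin m → Set
Attract E ea eb =
  ∃[ c ] (Centroid E c × ∃[ p ] (IsPath (allEdges E) p × HasEndpoint c p
      × OnPath (lookup E ea) p × OnPath (lookup E eb) p))

module Submission where

-- Proposition 5.4.  Let ea ≠ eb be edges of a tree T on n vertices with small
-- sides A, B of sizes i ≥ k.  Since k ≤ i ≤ n ∸ i, either B ⊆ A and eb lies in
-- A (nested) or A ∩ B = ∅ (disjoint).  When nested, T ∖ {ea, eb} has parts of
-- sizes k, i ∸ k, n ∸ i, and a path from a centroid (outside A, or the big end
-- of ea when n ∸ i = i) to the small end of eb crosses both edges.  When
-- disjoint, the parts have sizes i, k, n ∸ i ∸ k, which form re(n ∸ i, i ∸ k, k)
-- exactly when n ∸ i = i; then the small end of ea is a centroid and the edges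
-- attract, while otherwise every centroid lies outside A ∪ B and a path from it
-- cannot cross into both A and B.

open import Defs
open import Data.Nat using (ℕ; _≤_; _∸_)
open import Data.Fin using (Fin)
open import Data.Fin.Subset using (⁅_⁆; _∪_)
open import Data.List using (List; []; _∷_)
open import Relation.Binary.PropositionalEquality using (_≡_; _≢_)
open import Function.Bundles using (_⇔_)

open import Data.Nat using (zero; suc; _<_; _+_; z≤n; s≤s; _≤ᵇ_; _<ᵇ_) renaming (_≟_ to _≟ℕ_)
import Data.Nat.Properties as ℕₚ
open import Data.Bool using (Bool; true; false; if_then_else_; _∨_; _∧_; not; T)
open import Data.Bool.Properties using (T?)
open import Data.Fin using (toℕ) renaming (_≟_ to _≟ᶠ_)
import Data.Fin as Fin
import Data.Fin.Properties as Finₚ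
open import Data.Fin.Subset using (Subset; ∣_∣; ∁; inside)
import Data.Fin.Subset as Sub
import Data.Fin.Subset.Properties as Subₚ
open import Data.List using (_∷ʳ_; length; map; filterᵇ; allFin; tabulate; _++_; reverse)
import Data.List.Properties as Listₚ
open import Data.List.Membership.Propositional using (_∈_; _∉_; find)
import Data.List.Membership.Propositional.Properties as ∈ₚ
open import Data.List.Membership.Propositional.Properties.WithK using (unique∧set⇒bag)
open import Data.List.Relation.Binary.BagAndSetEquality using (∼bag⇒↭)
open import Data.List.Relation.Unary.Any using (here; there)
import Data.List.Relation.Unary.Any as Any
open import Data.List.Relation.Unary.All using ([]; _∷_)
import Data.List.Relation.Unary.All as All
import Data.List.Relation.Unary.All.Properties as Allₚ
open import Data.List.Relation.Unary.AllPairs using (AllPairs; []; _∷_)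
import Data.List.Relation.Unary.AllPairs as AllPairs
open import Data.List.Relation.Unary.Unique.Propositional using (Unique)
import Data.List.Relation.Unary.Unique.Propositional.Properties as Uniqueₚ
open import Data.List.Relation.Unary.Linked using (Linked; [-]; _∷_)
open import Data.List.Relation.Binary.Permutation.Propositional using (_↭_; ↭-sym; ↭-trans; ↭-prep; ↭-swap; ↭-refl; ↭⇒↭ₛ)
import Data.List.Relation.Binary.Permutation.Propositional.Properties as ↭ₚ
import Data.List.Relation.Binary.Permutation.Setoid.Properties as ↭ₛₚ
open import Data.List.Relation.Binary.Pointwise using (Pointwise-≡⇒≡)
open import Data.List.Relation.Unary.Sorted.TotalOrder.Properties using (↗↭↗⇒≋)
open import Relation.Binary.Properties.DecTotalOrder ℕₚ.≤-decTotalOrder using (≥-decTotalOrder; ≥-totalOrder)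
import Data.List.Sort.InsertionSort ≥-decTotalOrder as InsertionSort
import Data.List.Sort.InsertionSort.Properties ≥-decTotalOrder as InsertionSortₚ
open import Data.Vec using (lookup; []; _∷_; _[_]≔_)
import Data.Vec as Vec
import Data.Vec.Properties as Vecₚ
open import Data.Product using (Σ; ∃; _×_; _,_; proj₁; proj₂)
open import Data.Sum using (_⊎_; inj₁; inj₂)
open import Data.Unit using (⊤; tt)
open import Data.Empty using (⊥; ⊥-elim)
open import Relation.Nullary using (¬_; does; yes; no; Dec)
open import Relation.Binary.PropositionalEquality using (refl; sym; trans; cong; cong₂; subst; subst₂; setoid)
open import Relation.Binary.Definitions using (DecidableEquality; tri<; tri≈; tri>)
open import Function using (_∘_; id)
open import Function.Bundles using (mk⇔)

b≡true⊎b≡false : ∀ (b : Bool) → b ≡ true ⊎ b ≡ false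
b≡true⊎b≡false true  = inj₁ refl
b≡true⊎b≡false false = inj₂ refl

T⇒≡true : ∀ {b} → T b → b ≡ true
T⇒≡true {true} _ = refl

≡true⇒T : ∀ {b} → b ≡ true → T b
≡true⇒T refl = tt

if-true : ∀ {A : Set} {b} {x y : A} → b ≡ true → (if b then x else y) ≡ x
if-true refl = refl

if-false : ∀ {A : Set} {b} {x y : A} → b ≡ false → (if b then x else y) ≡ y
if-false refl = refl

∨-introˡ : ∀ {a} b → a ≡ true → (a ∨ b) ≡ true
∨-introˡ b refl = refl

∨-introʳ : ∀ a {b} → b ≡ true → (a ∨ b) ≡ true
∨-introʳ true  refl = refl
∨-introʳ false refl = refl

∨-elim : ∀ a b → (a ∨ b) ≡ true → a ≡ true ⊎ b ≡ true
∨-elim true  b p = inj₁ refl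
∨-elim false b p = inj₂ p

∧-intro : ∀ {a b} → a ≡ true → b ≡ true → (a ∧ b) ≡ true
∧-intro refl refl = refl

∧-elim : ∀ a b → (a ∧ b) ≡ true → a ≡ true × b ≡ true
∧-elim true true p = refl , refl

≤ᵇ-true⇒≤ : ∀ a b → (a ≤ᵇ b) ≡ true → a ≤ b
≤ᵇ-true⇒≤ a b p = ℕₚ.≤ᵇ⇒≤ a b (≡true⇒T p)

≤ᵇ-false⇒> : ∀ a b → (a ≤ᵇ b) ≡ false → b < a
≤ᵇ-false⇒> a b p = ℕₚ.≰⇒> λ q → subst T p (ℕₚ.≤⇒≤ᵇ q)

unique-∷ : ∀ {A : Set} {x : A} {xs} → x ∉ xs → Unique xs → Unique (x ∷ xs)
unique-∷ {xs = xs} x∉ u = Allₚ.¬Any⇒All¬ xs x∉ ∷ u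

unique-head : ∀ {A : Set} {x : A} {xs} → Unique (x ∷ xs) → x ∉ xs
unique-head = Uniqueₚ.Unique[x∷xs]⇒x∉xs

unique-tail : ∀ {A : Set} {x : A} {xs} → Unique (x ∷ xs) → Unique xs
unique-tail = AllPairs.tail

unique-⊆⇒length≤ : ∀ {A : Set} {xs ys : List A} → Unique xs → (∀ z → z ∈ xs → z ∈ ys) →
  length xs ≤ length ys
unique-⊆⇒length≤ {xs = []} u s = z≤n
unique-⊆⇒length≤ {xs = x ∷ xs} {ys} u s with ∈ₚ.∈-∃++ (s x (here refl))
... | ys₁ , ys₂ , refl =
  subst (suc (length xs) ≤_) (sym (length-middle ys₁))
    (s≤s (unique-⊆⇒length≤ (unique-tail u) λ z z∈ →
      delete-middle ys₁ (s z (there z∈)) λ { refl → unique-head u z∈ }))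
  where
  length-middle : ∀ zs → length (zs ++ x ∷ ys₂) ≡ suc (length (zs ++ ys₂))
  length-middle []       = refl
  length-middle (_ ∷ zs) = cong suc (length-middle zs)
  delete-middle : ∀ {z} zs → z ∈ zs ++ x ∷ ys₂ → z ≢ x → z ∈ zs ++ ys₂
  delete-middle []       (here p)  ne = ⊥-elim (ne p)
  delete-middle []       (there p) ne = p
  delete-middle (_ ∷ zs) (here p)  ne = here p
  delete-middle (_ ∷ zs) (there p) ne = there (delete-middle zs p ne)

unique-same-elements⇒↭ : ∀ {A : Set} {xs ys : List A} → Unique xs → Unique ys →
  (∀ {z} → z ∈ xs → z ∈ ys) → (∀ {z} → z ∈ ys → z ∈ xs) → xs ↭ ys
unique-same-elements⇒↭ u v f g = ∼bag⇒↭ (unique∧set⇒bag u v (mk⇔ f g))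

allPairs-lookup : ∀ {A : Set} {S : A → A → Set} {xs : List A} → AllPairs S xs →
  ∀ {x y} → x ∈ xs → y ∈ xs → x ≡ y ⊎ S x y ⊎ S y x
allPairs-lookup (a ∷ ap) (here refl) (here refl) = inj₁ refl
allPairs-lookup (a ∷ ap) (here refl) (there y∈) = inj₂ (inj₁ (All.lookup a y∈))
allPairs-lookup (a ∷ ap) (there x∈) (here refl) = inj₂ (inj₂ (All.lookup a x∈))
allPairs-lookup (a ∷ ap) (there x∈) (there y∈) = allPairs-lookup ap x∈ y∈

unique-reverse : ∀ {A : Set} {xs : List A} → Unique xs → Unique (reverse xs)
unique-reverse {A} {xs} = ↭ₛₚ.Unique-resp-↭ (setoid A) (↭⇒↭ₛ (↭-sym (↭ₚ.↭-reverse xs)))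

data Suffix {A : Set} : List A → List A → Set where
  suffix-refl : ∀ {l} → Suffix l l
  suffix-∷    : ∀ {s x l} → Suffix s l → Suffix s (x ∷ l)

suffix-comparable : ∀ {A : Set} {s t l : List A} → Suffix s l → Suffix t l → Suffix s t ⊎ Suffix t s
suffix-comparable suffix-refl  q            = inj₂ q
suffix-comparable (suffix-∷ p) suffix-refl  = inj₁ (suffix-∷ p)
suffix-comparable (suffix-∷ p) (suffix-∷ q) = suffix-comparable p q

suffix-head : ∀ {A : Set} {a : A} {t u} → Suffix (a ∷ t) u → a ∈ u
suffix-head suffix-refl  = here refl
suffix-head (suffix-∷ p) = there (suffix-head p)

unique-map : ∀ {A B : Set} (f : A → B) {xs : List A} → Unique xs →
  (∀ x x' → x ∈ xs → x' ∈ xs → f x ≡ f x' → x ≡ x') → Unique (map f xs)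
unique-map f {[]} u inj = []
unique-map f {x ∷ xs} u inj =
  unique-∷ (λ p → let (y , y∈ , eq) = ∈ₚ.∈-map⁻ f p in
                  unique-head u (subst (_∈ xs) (sym (inj x y (here refl) (there y∈) eq)) y∈))
           (unique-map f (unique-tail u) λ a b a∈ b∈ → inj a b (there a∈) (there b∈))

-- Sorting: sortDesc is insertion sort for the order ≥, so the library's
-- correctness proof applies; hence sortDesc only depends on the multiset.

insertDesc≡insert : ∀ x ys → insertDesc x ys ≡ InsertionSort.insert x ys
insertDesc≡insert x []       = refl
insertDesc≡insert x (y ∷ ys) =
  cong (λ zs → if y ≤ᵇ x then x ∷ y ∷ ys else y ∷ zs) (insertDesc≡insert x ys)

sortDesc≡sort : ∀ xs → sortDesc xs ≡ InsertionSort.sort xs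
sortDesc≡sort []       = refl
sortDesc≡sort (x ∷ xs) rewrite sortDesc≡sort xs = insertDesc≡insert x (InsertionSort.sort xs)

sortDesc-↭ : ∀ xs → sortDesc xs ↭ xs
sortDesc-↭ xs rewrite sortDesc≡sort xs = InsertionSortₚ.sort-↭ xs

sortDesc-cong : ∀ {xs ys} → xs ↭ ys → sortDesc xs ≡ sortDesc ys
sortDesc-cong {xs} {ys} p rewrite sortDesc≡sort xs | sortDesc≡sort ys =
  Pointwise-≡⇒≡ (↗↭↗⇒≋ ≥-totalOrder (InsertionSortₚ.sort-↗ xs) (InsertionSortₚ.sort-↗ ys)
    (↭⇒↭ₛ (↭-trans (InsertionSortₚ.sort-↭ xs) (↭-trans p (↭-sym (InsertionSortₚ.sort-↭ ys))))))

-- Finite subsets.  X ∋ x is membership read off as a Boolean lookup, which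
-- is how the definitions (comp, θ, degIn) compute with subsets.

_∋_ : ∀ {n} → Subset n → Fin n → Set
X ∋ x = lookup X x ≡ true

∋⇒∈ : ∀ {n} {X : Subset n} {x} → X ∋ x → x Sub.∈ X
∋⇒∈ {X = X} {x} p = Vecₚ.lookup⇒[]= x X p

∈⇒∋ : ∀ {n} {X : Subset n} {x} → x Sub.∈ X → X ∋ x
∈⇒∋ p = Vecₚ.[]=⇒lookup p

∋-⁅⁆ : ∀ {n} (v : Fin n) → ⁅ v ⁆ ∋ v
∋-⁅⁆ v = ∈⇒∋ (Subₚ.x∈⁅x⁆ v)

⁅⁆-∋ : ∀ {n} (v z : Fin n) → ⁅ v ⁆ ∋ z → z ≡ v
⁅⁆-∋ v z p = Subₚ.x∈⁅y⁆⇒x≡y v (∋⇒∈ {X = ⁅ v ⁆} p)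

card-mono : ∀ {n} (X Y : Subset n) → (∀ x → X ∋ x → Y ∋ x) → ∣ X ∣ ≤ ∣ Y ∣
card-mono X Y f = Subₚ.p⊆q⇒∣p∣≤∣q∣ {p = X} {q = Y} (λ {x} p → ∋⇒∈ {X = Y} (f x (∈⇒∋ p)))

card-strict : ∀ {n} (X Y : Subset n) → (∀ x → X ∋ x → Y ∋ x) →
  (y : Fin n) → Y ∋ y → ¬ (X ∋ y) → ∣ X ∣ < ∣ Y ∣
card-strict X Y f y yY yX = Subₚ.p⊂q⇒∣p∣<∣q∣ {p = X} {q = Y}
  ((λ {x} p → ∋⇒∈ {X = Y} (f x (∈⇒∋ p))) , y , ∋⇒∈ {X = Y} yY , λ p → yX (∈⇒∋ p))

card-cong : ∀ {n} (X Y : Subset n) → (∀ x → X ∋ x → Y ∋ x) → (∀ x → Y ∋ x → X ∋ x) →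
  ∣ X ∣ ≡ ∣ Y ∣
card-cong X Y f g = ℕₚ.≤-antisym (card-mono X Y f) (card-mono Y X g)

card-nonempty : ∀ {n} (X : Subset n) x → X ∋ x → 1 ≤ ∣ X ∣
card-nonempty {n} X x p = subst (_< ∣ X ∣) (Subₚ.∣⊥∣≡0 n)
  (card-strict Sub.⊥ X (λ y q → ⊥-elim (Subₚ.∉⊥ (∋⇒∈ {X = Sub.⊥ {n}} {y} q))) x p
    (λ q → Subₚ.∉⊥ (∋⇒∈ {X = Sub.⊥ {n}} {x} q)))

card-disjoint-union : ∀ {n} (X Y Z : Subset n) → (∀ x → Z ∋ x → X ∋ x ⊎ Y ∋ x) →
  (∀ x → X ∋ x → Z ∋ x) → (∀ x → Y ∋ x → Z ∋ x) → (∀ x → X ∋ x → Y ∋ x → ⊥) →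
  ∣ Z ∣ ≡ ∣ X ∣ + ∣ Y ∣
card-disjoint-union [] [] [] _ _ _ _ = refl
card-disjoint-union (x ∷ X) (y ∷ Y) (z ∷ Z) cover inX inY disj =
  head-step x y z (cover Fin.zero) (inX Fin.zero) (inY Fin.zero) (disj Fin.zero)
    (card-disjoint-union X Y Z (cover ∘ Fin.suc) (inX ∘ Fin.suc) (inY ∘ Fin.suc) (disj ∘ Fin.suc))
  where
  head-step : ∀ x y z → (z ≡ true → x ≡ true ⊎ y ≡ true) → (x ≡ true → z ≡ true) →
    (y ≡ true → z ≡ true) → (x ≡ true → y ≡ true → ⊥) → ∣ Z ∣ ≡ ∣ X ∣ + ∣ Y ∣ →
    ∣ z ∷ Z ∣ ≡ ∣ x ∷ X ∣ + ∣ y ∷ Y ∣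
  head-step false false false _ _ _ _ e = e
  head-step false false true  c _ _ _ e with c refl
  ... | inj₁ ()
  ... | inj₂ ()
  head-step false true  false _ _ b _ e with b refl
  ... | ()
  head-step false true  true  _ _ _ _ e = trans (cong suc e) (sym (ℕₚ.+-suc ∣ X ∣ ∣ Y ∣))
  head-step true  y     false _ a _ _ e with a refl
  ... | ()
  head-step true  false true  _ _ _ _ e = cong suc e
  head-step true  true  true  _ _ _ d e = ⊥-elim (d refl refl)

elements : ∀ {n} → Subset n → List (Fin n)
elements {n} X = filterᵇ (lookup X) (allFin n)

∈-elements⁻ : ∀ {n} (X : Subset n) x → x ∈ elements X → X ∋ x
∈-elements⁻ {n} X x p = T⇒≡true (proj₂ (∈ₚ.∈-filter⁻ (T? ∘ lookup X) {xs = allFin n} p))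

∈-elements⁺ : ∀ {n} (X : Subset n) x → X ∋ x → x ∈ elements X
∈-elements⁺ X x p = ∈ₚ.∈-filter⁺ (T? ∘ lookup X) (∈ₚ.∈-allFin x) (≡true⇒T p)

elements-unique : ∀ {n} (X : Subset n) → Unique (elements X)
elements-unique {n} X = Uniqueₚ.filter⁺ (T? ∘ lookup X) (Uniqueₚ.allFin⁺ n)

length-elements : ∀ {n} (X : Subset n) → length (elements X) ≡ ∣ X ∣
length-elements X = trans (count id (lookup X)) (cong ∣_∣ (Vecₚ.tabulate∘lookup X))
  where
  count : ∀ {n} {A : Set} (f : Fin n → A) (P : A → Bool) →
    length (filterᵇ P (tabulate f)) ≡ ∣ Vec.tabulate (P ∘ f) ∣
  count {zero}  f P = refl
  count {suc n} f P with P (f Fin.zero)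
  ... | true  = cong suc (count (f ∘ Fin.suc) P)
  ... | false = count (f ∘ Fin.suc) P

card-injection : ∀ {n m} (X : Subset n) (Y : Subset m) (f : Fin n → Fin m) →
  (∀ x → X ∋ x → Y ∋ f x) → (∀ x x' → X ∋ x → X ∋ x' → f x ≡ f x' → x ≡ x') →
  ∣ X ∣ ≤ ∣ Y ∣
card-injection X Y f into inj = subst₂ _≤_ (trans (Listₚ.length-map f (elements X)) (length-elements X))
  (length-elements Y)
  (unique-⊆⇒length≤ (unique-map f (elements-unique X)
      (λ a b a∈ b∈ → inj a b (∈-elements⁻ X a a∈) (∈-elements⁻ X b b∈)))
    λ z z∈ → let (a , a∈ , eq) = ∈ₚ.∈-map⁻ f z∈ in
      subst (_∈ elements Y) (sym eq) (∈-elements⁺ Y (f a) (into a (∈-elements⁻ X a a∈))))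

∁⁅⁆-∋ : ∀ {k} (g j : Fin k) → j ≢ g → ∁ ⁅ g ⁆ ∋ j
∁⁅⁆-∋ g j j≢g = ∈⇒∋ (Subₚ.x∉p⇒x∈∁p (λ p → j≢g (Subₚ.x∈⁅y⁆⇒x≡y g p)))

∋-∁⁅⁆ : ∀ {k} (g j : Fin k) → ∁ ⁅ g ⁆ ∋ j → j ≢ g
∋-∁⁅⁆ g j p refl = Subₚ.x∈∁p⇒x∉p (∋⇒∈ {X = ∁ ⁅ g ⁆} p) (Subₚ.x∈⁅x⁆ g)

∁⁅⁆∪⁅⁆-∋ : ∀ {k} (a b j : Fin k) → j ≢ a → j ≢ b → ∁ (⁅ a ⁆ ∪ ⁅ b ⁆) ∋ j
∁⁅⁆∪⁅⁆-∋ a b j j≢a j≢b = ∈⇒∋ (Subₚ.x∉p⇒x∈∁p λ q → either (Subₚ.x∈p∪q⁻ ⁅ a ⁆ ⁅ b ⁆ q))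
  where
  either : j Sub.∈ ⁅ a ⁆ ⊎ j Sub.∈ ⁅ b ⁆ → ⊥
  either (inj₁ p) = j≢a (Subₚ.x∈⁅y⁆⇒x≡y a p)
  either (inj₂ p) = j≢b (Subₚ.x∈⁅y⁆⇒x≡y b p)

∋-∁⁅⁆∪⁅⁆ : ∀ {k} (a b j : Fin k) → ∁ (⁅ a ⁆ ∪ ⁅ b ⁆) ∋ j → j ≢ a × j ≢ b
∋-∁⁅⁆∪⁅⁆ a b j p =
    (λ { refl → out (Subₚ.p⊆p∪q ⁅ b ⁆ (Subₚ.x∈⁅x⁆ a)) })
  , (λ { refl → out (Subₚ.q⊆p∪q ⁅ a ⁆ ⁅ b ⁆ (Subₚ.x∈⁅x⁆ b)) })
  where
  out : ¬ j Sub.∈ (⁅ a ⁆ ∪ ⁅ b ⁆)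
  out = Subₚ.x∈∁p⇒x∉p (∋⇒∈ {X = ∁ (⁅ a ⁆ ∪ ⁅ b ⁆)} p)

module RelationWalks {A : Set} (_≟_ : DecidableEquality A) where

  import Data.List.Membership.DecPropositional _≟_ as DecMembership

  data RWalk (R : A → A → Set) : A → A → Set where
    wnil  : ∀ {u} → RWalk R u u
    wcons : ∀ {u w v} → R u w → RWalk R w v → RWalk R u v

  data RPath (R : A → A → Set) : A → A → List A → Set where
    pnil  : ∀ {u} → RPath R u u (u ∷ [])
    pcons : ∀ {u w v l} → R u w → RPath R w v l → RPath R u v (u ∷ l)

  module _ {R : A → A → Set} where

    infixr 5 _⊙_
    _⊙_ : ∀ {u w v} → RWalk R u w → RWalk R w v → RWalk R u v
    wnil      ⊙ q = q
    wcons r p ⊙ q = wcons r (p ⊙ q)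

    walk-reverse : (∀ {a b} → R a b → R b a) → ∀ {u v} → RWalk R u v → RWalk R v u
    walk-reverse s wnil        = wnil
    walk-reverse s (wcons r p) = walk-reverse s p ⊙ wcons (s r) wnil

    walk-map : ∀ {R' : A → A → Set} → (∀ {a b} → R a b → R' a b) → ∀ {u v} →
      RWalk R u v → RWalk R' u v
    walk-map f wnil        = wnil
    walk-map f (wcons r p) = wcons (f r) (walk-map f p)

    path-map : ∀ {R' : A → A → Set} → (∀ {a b} → R a b → R' a b) → ∀ {u v l} →
      RPath R u v l → RPath R' u v l
    path-map f pnil        = pnil
    path-map f (pcons r p) = pcons (f r) (path-map f p)

    path⇒walk : ∀ {u v l} → RPath R u v l → RWalk R u v
    path⇒walk pnil        = wnil
    path⇒walk (pcons r p) = wcons r (path⇒walk p)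

    path-head : ∀ {u v l} → RPath R u v l → ∃ λ t → l ≡ u ∷ t
    path-head pnil        = _ , refl
    path-head (pcons r p) = _ , refl

    path-prefix : ∀ {u v l z} → RPath R u v l → z ∈ l → RWalk R u z
    path-prefix pnil        (here refl) = wnil
    path-prefix (pcons r p) (here refl) = wnil
    path-prefix (pcons r p) (there z∈) = wcons r (path-prefix p z∈)

    path-suffix : ∀ {w v l z} → RPath R w v l → Unique l → z ∈ l →
      ∃ λ l' → RPath R z v l' × Unique l'
    path-suffix pnil        u (here refl) = _ , pnil , u
    path-suffix (pcons r p) u (here refl) = _ , pcons r p , u
    path-suffix (pcons r p) u (there z∈) = path-suffix p (unique-tail u) z∈

    shortcut : ∀ {u v} → RWalk R u v → ∃ λ l → RPath R u v l × Unique l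
    shortcut {u = u} wnil = u ∷ [] , pnil , unique-∷ (λ ()) []
    shortcut {u = u} (wcons r p) with shortcut p
    ... | l , q , uq with DecMembership._∈?_ u l
    ... | yes u∈ = path-suffix q uq u∈
    ... | no u∉  = u ∷ l , pcons r q , unique-∷ u∉ uq

    path⇒linked : ∀ {u v l} → RPath R u v l → Linked R l
    path⇒linked pnil                    = [-]
    path⇒linked (pcons r pnil)          = r ∷ [-]
    path⇒linked (pcons r (pcons r' p)) = r ∷ path⇒linked (pcons r' p)

    linked⇒path : ∀ {x xs} → Linked R (x ∷ xs) → ∃ λ v → RPath R x v (x ∷ xs)
    linked⇒path [-]     = _ , pnil
    linked⇒path (r ∷ l) = let (v , p) = linked⇒path l in v , pcons r p

    path-snoc : ∀ {u v w l} → RPath R u v l → R v w → RPath R u w (l ∷ʳ w)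
    path-snoc pnil         r = pcons r pnil
    path-snoc (pcons r' p) r = pcons r' (path-snoc p r)

    path-reverse : (∀ {a b} → R a b → R b a) → ∀ {u v l} → RPath R u v l →
      RPath R v u (reverse l)
    path-reverse s pnil = pnil
    path-reverse s {u = u} (pcons {l = l} r p) =
      subst (RPath _ _ u) (sym (Listₚ.unfold-reverse u l)) (path-snoc (path-reverse s p) (s r))

module Components {n : ℕ} where

  open RelationWalks (_≟ᶠ_ {n})
  open import Data.Bool.ListAction using (any)
  import Data.List.Relation.Unary.Any.Properties as Anyₚ
  import Data.List.Extrema ℕₚ.≤-totalOrder as Extrema

  Graph : Set
  Graph = List (Fin n × Fin n)

  adj-sym : ∀ {L : Graph} {u v} → Adj L u v → Adj L v u
  adj-sym (inj₁ p) = inj₂ p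
  adj-sym (inj₂ p) = inj₁ p

  walk⇒rwalk : ∀ {L : Graph} {u v} → Walk L u v → RWalk (Adj L) u v
  walk⇒rwalk here       = wnil
  walk⇒rwalk (step a w) = wcons a (walk⇒rwalk w)

  rwalk⇒walk : ∀ {L : Graph} {u v} → RWalk (Adj L) u v → Walk L u v
  rwalk⇒walk wnil        = here
  rwalk⇒walk (wcons a w) = step a (rwalk⇒walk w)

  walk-sym : ∀ {L : Graph} {u v} → Walk L u v → Walk L v u
  walk-sym w = rwalk⇒walk (walk-reverse adj-sym (walk⇒rwalk w))

  walk-trans : ∀ {L : Graph} {u w v} → Walk L u w → Walk L w v → Walk L u v
  walk-trans p q = rwalk⇒walk (walk⇒rwalk p ⊙ walk⇒rwalk q)

  update-∋ : ∀ (X : Subset n) i j → X ∋ j ⊎ i ≡ j → (X [ i ]≔ true) ∋ j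
  update-∋ X i j h with i ≟ᶠ j
  ... | yes refl = Vecₚ.lookup∘update i X true
  ... | no i≢j with h
  ...   | inj₁ p = trans (Vecₚ.lookup∘update′ (i≢j ∘ sym) X true) p
  ...   | inj₂ e = ⊥-elim (i≢j e)

  ∋-update : ∀ (X : Subset n) i j → (X [ i ]≔ true) ∋ j → X ∋ j ⊎ j ≡ i
  ∋-update X i j h with i ≟ᶠ j
  ... | yes refl = inj₂ refl
  ... | no i≢j   = inj₁ (trans (sym (Vecₚ.lookup∘update′ (i≢j ∘ sym) X true)) h)

  addEdge-mono : ∀ x y (R : Subset n) z → R ∋ z → addEdge (x , y) R ∋ z
  addEdge-mono x y R z p with b≡true⊎b≡false (lookup R x ∨ lookup R y)
  ... | inj₁ e = trans (cong (λ S → lookup S z) (if-true e))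
                   (update-∋ (R [ x ]≔ true) y z (inj₁ (update-∋ R x z (inj₁ p))))
  ... | inj₂ e = trans (cong (λ S → lookup S z) (if-false e)) p

  addEdge-ends : ∀ x y (R : Subset n) → R ∋ x ⊎ R ∋ y →
    addEdge (x , y) R ∋ x × addEdge (x , y) R ∋ y
  addEdge-ends x y R h =
      trans (cong (λ S → lookup S x) (if-true e)) (update-∋ (R [ x ]≔ true) y x (inj₁ (update-∋ R x x (inj₂ refl))))
    , trans (cong (λ S → lookup S y) (if-true e)) (update-∋ (R [ x ]≔ true) y y (inj₂ refl))
    where
    present : R ∋ x ⊎ R ∋ y → (lookup R x ∨ lookup R y) ≡ true
    present (inj₁ p) = ∨-introˡ (lookup R y) p
    present (inj₂ p) = ∨-introʳ (lookup R x) p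
    e : (lookup R x ∨ lookup R y) ≡ true
    e = present h

  addEdge-new : ∀ x y (R : Subset n) z → addEdge (x , y) R ∋ z →
    R ∋ z ⊎ ((z ≡ x ⊎ z ≡ y) × (R ∋ x ⊎ R ∋ y))
  addEdge-new x y R z p with b≡true⊎b≡false (lookup R x ∨ lookup R y)
  ... | inj₂ e = inj₁ (trans (sym (cong (λ S → lookup S z) (if-false e))) p)
  ... | inj₁ e with ∋-update (R [ x ]≔ true) y z (trans (sym (cong (λ S → lookup S z) (if-true e))) p)
  ...   | inj₂ z≡y = inj₂ (inj₂ z≡y , ∨-elim _ _ e)
  ...   | inj₁ q with ∋-update R x z q
  ...     | inj₁ r   = inj₁ r
  ...     | inj₂ z≡x = inj₂ (inj₁ z≡x , ∨-elim _ _ e)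

  pass-mono : ∀ (L : Graph) R z → R ∋ z → pass L R ∋ z
  pass-mono []            R z p = p
  pass-mono ((x , y) ∷ L) R z p = addEdge-mono x y (pass L R) z (pass-mono L R z p)

  pass-adj : ∀ (L : Graph) R a b → Adj L a b → R ∋ a → pass L R ∋ b
  pass-adj ((x , y) ∷ L) R a b (inj₁ (here refl)) ra =
    proj₂ (addEdge-ends x y (pass L R) (inj₁ (pass-mono L R a ra)))
  pass-adj ((x , y) ∷ L) R a b (inj₂ (here refl)) ra =
    proj₁ (addEdge-ends x y (pass L R) (inj₂ (pass-mono L R a ra)))
  pass-adj ((x , y) ∷ L) R a b (inj₁ (there p)) ra =
    addEdge-mono x y (pass L R) b (pass-adj L R a b (inj₁ p) ra)
  pass-adj ((x , y) ∷ L) R a b (inj₂ (there p)) ra =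
    addEdge-mono x y (pass L R) b (pass-adj L R a b (inj₂ p) ra)

  pass-sound : ∀ {L : Graph} {v} (L' : Graph) → (∀ e → e ∈ L' → e ∈ L) →
    ∀ R → (∀ z → R ∋ z → Walk L v z) → ∀ z → pass L' R ∋ z → Walk L v z
  pass-sound [] sub R s z p = s z p
  pass-sound {L} {v} ((x , y) ∷ L') sub R s z p = extend (addEdge-new x y (pass L' R) z p)
    where
    reach : ∀ z → pass L' R ∋ z → Walk L v z
    reach = pass-sound L' (λ e e∈ → sub e (there e∈)) R s
    xy : Adj L x y
    xy = inj₁ (sub (x , y) (here refl))
    reach-x : pass L' R ∋ x ⊎ pass L' R ∋ y → Walk L v x
    reach-x (inj₁ q) = reach x q
    reach-x (inj₂ q) = walk-trans (reach y q) (step (adj-sym xy) here)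
    reach-y : pass L' R ∋ x ⊎ pass L' R ∋ y → Walk L v y
    reach-y (inj₁ q) = walk-trans (reach x q) (step xy here)
    reach-y (inj₂ q) = reach y q
    extend : pass L' R ∋ z ⊎ ((z ≡ x ⊎ z ≡ y) × (pass L' R ∋ x ⊎ pass L' R ∋ y)) → Walk L v z
    extend (inj₁ q)            = reach z q
    extend (inj₂ (inj₁ e , q)) = subst (Walk L v) (sym e) (reach-x q)
    extend (inj₂ (inj₂ e , q)) = subst (Walk L v) (sym e) (reach-y q)

  iter-sound : ∀ (L : Graph) v k z → iter k (pass L) ⁅ v ⁆ ∋ z → Walk L v z
  iter-sound L v zero    z p rewrite ⁅⁆-∋ v z p = here
  iter-sound L v (suc k) z p = pass-sound L (λ e e∈ → e∈) _ (iter-sound L v k) z p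

  comp-sound : ∀ (L : Graph) v z → comp L v ∋ z → Walk L v z
  comp-sound L v = iter-sound L v n

  iter-path : ∀ (L : Graph) {u w l} → RPath (Adj L) u w l → ∀ R → R ∋ u →
    iter (length l) (pass L) R ∋ w
  iter-path L pnil R r = pass-mono L R _ r
  iter-path L {u} {w} (pcons {w = u'} {l = l} a p) R r =
    subst (λ S → S ∋ w) (iter-shift (length l))
      (iter-path L p (pass L R) (pass-adj L R u u' a r))
    where
    iter-shift : ∀ k → iter k (pass L) (pass L R) ≡ pass L (iter k (pass L) R)
    iter-shift zero    = refl
    iter-shift (suc k) = cong (pass L) (iter-shift k)

  iter-mono : ∀ (L : Graph) R k d z → iter k (pass L) R ∋ z → iter (d + k) (pass L) R ∋ z
  iter-mono L R k zero    z p = p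
  iter-mono L R k (suc d) z p = pass-mono L _ z (iter-mono L R k d z p)

  -- Every reachable vertex is found: a shortest path has at most n vertices.
  comp-complete : ∀ (L : Graph) v z → Walk L v z → comp L v ∋ z
  comp-complete L v z w with shortcut (walk⇒rwalk w)
  ... | l , p , u = subst (λ k → iter k (pass L) ⁅ v ⁆ ∋ z) (ℕₚ.m∸n+n≡m l≤n)
         (iter-mono L ⁅ v ⁆ (length l) (n ∸ length l) z (iter-path L p ⁅ v ⁆ (∋-⁅⁆ v)))
    where
    l≤n : length l ≤ n
    l≤n = subst (length l ≤_) (Listₚ.length-tabulate id) (unique-⊆⇒length≤ u (λ z _ → ∈ₚ.∈-allFin z))

  comp-self : ∀ (L : Graph) a → comp L a ∋ a
  comp-self L a = comp-complete L a a here

  comp-walk : ∀ (L : Graph) a b → Walk L a b → ∀ z → comp L b ∋ z → comp L a ∋ z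
  comp-walk L a b w z p = comp-complete L a z (walk-trans w (comp-sound L b z p))

  Smaller : Graph → Fin n → Fin n → Bool
  Smaller L v w = (toℕ w <ᵇ toℕ v) ∧ lookup (comp L v) w

  isRep-minimal : ∀ (L : Graph) v → isRep L v ≡ true → ∀ w → toℕ w < toℕ v → ¬ comp L v ∋ w
  isRep-minimal L v r w w<v w∈ = absurd (any (Smaller L v) (allFin n)) r
    (Anyₚ.any⁺ (Smaller L v) (Any.map (λ { refl → ≡true⇒T
      (∧-intro (T⇒≡true (ℕₚ.<⇒<ᵇ w<v)) w∈) }) (∈ₚ.∈-allFin w)))
    where
    absurd : ∀ b → not b ≡ true → T b → ⊥
    absurd true () _

  minimal-isRep : ∀ (L : Graph) v → (∀ w → toℕ w < toℕ v → ¬ comp L v ∋ w) → isRep L v ≡ true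
  minimal-isRep L v h = not-false (any (Smaller L v) (allFin n))
    λ t → let (w , _ , s) = find (Anyₚ.any⁻ (Smaller L v) (allFin n) t)
              (w<v , w∈) = ∧-elim _ _ (T⇒≡true s)
          in h w (ℕₚ.<ᵇ⇒< _ _ (≡true⇒T w<v)) w∈
    where
    not-false : ∀ b → ¬ T b → not b ≡ true
    not-false false _ = refl
    not-false true  h = ⊥-elim (h tt)

  rep : Graph → Fin n → Fin n
  rep L r = Extrema.argmin toℕ r (elements (comp L r))

  rep-∈ : ∀ (L : Graph) r → comp L r ∋ rep L r
  rep-∈ L r = Extrema.argmin-all toℕ (comp-self L r)
    (All.tabulate λ {x} x∈ → ∈-elements⁻ (comp L r) x x∈)

  rep-≤ : ∀ (L : Graph) r w → comp L r ∋ w → toℕ (rep L r) ≤ toℕ w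
  rep-≤ L r w p = All.lookup (Extrema.f[argmin]≤f[xs] r (elements (comp L r)))
    (∈-elements⁺ (comp L r) w p)

  walk-rep : ∀ (L : Graph) r → Walk L r (rep L r)
  walk-rep L r = comp-sound L r _ (rep-∈ L r)

  rep-isRep : ∀ (L : Graph) r → isRep L (rep L r) ≡ true
  rep-isRep L r = minimal-isRep L (rep L r) λ w lt c →
    ℕₚ.<-irrefl refl (ℕₚ.<-≤-trans lt (rep-≤ L r w (comp-walk L r (rep L r) (walk-rep L r) w c)))

  isRep⇒rep : ∀ (L : Graph) r z → Walk L r z → isRep L z ≡ true → rep L r ≡ z
  isRep⇒rep L r z w ir with ℕₚ.<-cmp (toℕ (rep L r)) (toℕ z)
  ... | tri≈ _ e _  = Finₚ.toℕ-injective e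
  ... | tri< lt _ _ =
    ⊥-elim (isRep-minimal L z ir (rep L r) lt (comp-walk L z r (walk-sym w) _ (rep-∈ L r)))
  ... | tri> _ _ gt =
    ⊥-elim (ℕₚ.<-irrefl refl (ℕₚ.<-≤-trans gt (rep-≤ L r z (comp-complete L r z w))))

  size : Graph → Fin n → ℕ
  size L r = ∣ comp L r ∣

  size-rep : ∀ (L : Graph) r → size L (rep L r) ≡ size L r
  size-rep L r = card-cong (comp L (rep L r)) (comp L r)
    (comp-walk L r (rep L r) (walk-rep L r)) (comp-walk L (rep L r) r (walk-sym (walk-rep L r)))

  compSizes-↭ : ∀ (L : Graph) (rs : List (Fin n)) →
    (∀ z → ∃ λ r → r ∈ rs × Walk L r z) → AllPairs (λ r r' → ¬ Walk L r r') rs →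
    compSizes L ↭ map (size L) rs
  compSizes-↭ L rs cover separated =
    ↭-trans (↭ₚ.map⁺ (size L) reps↭)
      (subst (map (size L) (map (rep L) rs) ↭_)
        (trans (sym (Listₚ.map-∘ rs)) (Listₚ.map-cong (size-rep L) rs)) ↭-refl)
    where
    rs-unique : Unique rs
    rs-unique = AllPairs.map (λ nw e → nw (subst (Walk L _) e here)) separated
    connected : ∀ r r' → rep L r ≡ rep L r' → Walk L r r'
    connected r r' e =
      walk-trans (walk-rep L r) (subst (λ q → Walk L q r') (sym e) (walk-sym (walk-rep L r')))
    rep-inj : ∀ r r' → r ∈ rs → r' ∈ rs → rep L r ≡ rep L r' → r ≡ r'
    rep-inj r r' r∈ r'∈ e with allPairs-lookup separated r∈ r'∈
    ... | inj₁ eq         = eq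
    ... | inj₂ (inj₁ nw) = ⊥-elim (nw (connected r r' e))
    ... | inj₂ (inj₂ nw) = ⊥-elim (nw (connected r' r (sym e)))
    reps↭ : filterᵇ (isRep L) (allFin n) ↭ map (rep L) rs
    reps↭ = unique-same-elements⇒↭ (Uniqueₚ.filter⁺ (T? ∘ isRep L) (Uniqueₚ.allFin⁺ n))
      (unique-map (rep L) rs-unique rep-inj)
      (λ {z} z∈ → let ir = T⇒≡true (proj₂ (∈ₚ.∈-filter⁻ (T? ∘ isRep L) {xs = allFin n} z∈))
                      (r , r∈ , w) = cover z
                  in subst (_∈ map (rep L) rs) (isRep⇒rep L r z w ir) (∈ₚ.∈-map⁺ (rep L) r∈))
      (λ {z} z∈ → let (r , r∈ , e) = ∈ₚ.∈-map⁻ (rep L) z∈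
                  in ∈ₚ.∈-filter⁺ (T? ∘ isRep L) (∈ₚ.∈-allFin z)
                       (≡true⇒T (trans (cong (isRep L) e) (rep-isRep L r))))

module Tree {n m : ℕ} (E : Edges n m) (tree : IsTree E) where

  open IsTree tree
  open RelationWalks (_≟ᶠ_ {n}) public
  open Components {n}

  EdgePred : Set₁
  EdgePred = Fin m → Set

  end₁ end₂ : Fin m → Fin n
  end₁ j = proj₁ (lookup E j)
  end₂ j = proj₂ (lookup E j)

  Joins : Fin m → Fin n → Fin n → Set
  Joins j x y = lookup E j ≡ (x , y) ⊎ lookup E j ≡ (y , x)

  Step : EdgePred → Fin n → Fin n → Set
  Step p u w = Σ (Fin m) λ j → p j × Joins j u w

  WalkVia : EdgePred → Fin n → Fin n → Set
  WalkVia p = RWalk (Step p)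

  PathVia : EdgePred → Fin n → Fin n → List (Fin n) → Set
  PathVia p = RPath (Step p)

  AnyEdge : EdgePred
  AnyEdge _ = ⊤

  Avoid : Fin m → EdgePred
  Avoid g j = j ≢ g

  _∩ₑ_ : EdgePred → EdgePred → EdgePred
  (p ∩ₑ q) j = p j × q j

  joins-sym : ∀ {j x y} → Joins j x y → Joins j y x
  joins-sym (inj₁ e) = inj₂ e
  joins-sym (inj₂ e) = inj₁ e

  joins-ends : ∀ j → Joins j (end₁ j) (end₂ j)
  joins-ends j = inj₁ refl

  joins-cases : ∀ {j x y} → Joins j x y → (x ≡ end₁ j × y ≡ end₂ j) ⊎ (x ≡ end₂ j × y ≡ end₁ j)
  joins-cases (inj₁ e) = inj₁ (sym (cong proj₁ e) , sym (cong proj₂ e))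
  joins-cases (inj₂ e) = inj₂ (sym (cong proj₂ e) , sym (cong proj₁ e))

  joins-distinct : ∀ {j x y} → Joins j x y → x ≢ y
  joins-distinct {j} e x≡y with joins-cases e
  ... | inj₁ (a , b) = noLoop j (trans (sym a) (trans x≡y b))
  ... | inj₂ (a , b) = noLoop j (trans (sym b) (trans (sym x≡y) a))

  joins-endpoint : ∀ {j x y u w} → Joins j x y → Joins j u w → u ≡ x ⊎ u ≡ y
  joins-endpoint e f with joins-cases e | joins-cases f
  ... | inj₁ (a , b) | inj₁ (c , d) = inj₁ (trans c (sym a))
  ... | inj₁ (a , b) | inj₂ (c , d) = inj₂ (trans c (sym b))
  ... | inj₂ (a , b) | inj₁ (c , d) = inj₂ (trans c (sym b))
  ... | inj₂ (a , b) | inj₂ (c , d) = inj₁ (trans c (sym a))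

  joins-other : ∀ {j x y y'} → Joins j x y → Joins j x y' → y ≡ y'
  joins-other e f with joins-cases e | joins-cases f
  ... | inj₁ (a , b) | inj₁ (c , d) = trans b (sym d)
  ... | inj₁ (a , b) | inj₂ (c , d) = ⊥-elim (joins-distinct (joins-ends _) (trans (sym a) c))
  ... | inj₂ (a , b) | inj₁ (c , d) = ⊥-elim (joins-distinct (joins-ends _) (trans (sym c) a))
  ... | inj₂ (a , b) | inj₂ (c , d) = trans b (sym d)

  joins-unique : ∀ {j j' x y} → Joins j x y → Joins j' x y → j ≡ j'
  joins-unique {j} {j'} {x} {y} e f with j ≟ᶠ j'
  ... | yes p = p
  ... | no ne = ⊥-elim (noMulti j j' ne (same (joins-cases e) (joins-cases f)))
    where
    same : (x ≡ end₁ j × y ≡ end₂ j) ⊎ (x ≡ end₂ j × y ≡ end₁ j) →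
      (x ≡ end₁ j' × y ≡ end₂ j') ⊎ (x ≡ end₂ j' × y ≡ end₁ j') → SameEdge (lookup E j) (lookup E j')
    same (inj₁ (a , b)) (inj₁ (c , d)) = inj₁ (trans (sym a) c , trans (sym b) d)
    same (inj₁ (a , b)) (inj₂ (c , d)) = inj₂ (trans (sym a) c , trans (sym b) d)
    same (inj₂ (a , b)) (inj₁ (c , d)) = inj₂ (trans (sym b) d , trans (sym a) c)
    same (inj₂ (a , b)) (inj₂ (c , d)) = inj₁ (trans (sym b) d , trans (sym a) c)

  endpoint-joins : ∀ h x → x ≡ end₁ h ⊎ x ≡ end₂ h → Σ (Fin n) λ y → Joins h x y
  endpoint-joins h x (inj₁ refl) = _ , inj₁ refl
  endpoint-joins h x (inj₂ refl) = _ , inj₂ refl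

  step-sym : ∀ {p u w} → Step p u w → Step p w u
  step-sym (j , pj , e) = j , pj , joins-sym e

  via-mono : ∀ {p q : EdgePred} → (∀ j → p j → q j) → ∀ {u v} → WalkVia p u v → WalkVia q u v
  via-mono f = walk-map λ { (j , pj , e) → j , f j pj , e }

  via-weaken : ∀ {p q u v} → WalkVia (p ∩ₑ q) u v → WalkVia q u v
  via-weaken = via-mono (λ _ → proj₂)

  via-sym : ∀ {p u v} → WalkVia p u v → WalkVia p v u
  via-sym = walk-reverse step-sym

  edge-walk : ∀ {p j x y} → p j → Joins j x y → WalkVia p x y
  edge-walk pj e = wcons (_ , pj , e) wnil

  keep⇒step : ∀ (F : Subset m) {p : EdgePred} → (∀ j → F ∋ j → p j) →
    ∀ {u w} → Adj (keep E F) u w → Step p u w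
  keep⇒step F f (inj₁ mem) with ∈ₚ.∈-map⁻ (lookup E) mem
  ... | j , j∈ , eq = j , f j (∈-elements⁻ F j j∈) , inj₁ (sym eq)
  keep⇒step F f (inj₂ mem) with ∈ₚ.∈-map⁻ (lookup E) mem
  ... | j , j∈ , eq = j , f j (∈-elements⁻ F j j∈) , inj₂ (sym eq)

  step⇒keep : ∀ (F : Subset m) {p : EdgePred} → (∀ j → p j → F ∋ j) →
    ∀ {u w} → Step p u w → Adj (keep E F) u w
  step⇒keep F f (j , pj , inj₁ e) =
    inj₁ (subst (_∈ keep E F) e (∈ₚ.∈-map⁺ (lookup E) (∈-elements⁺ F j (f j pj))))
  step⇒keep F f (j , pj , inj₂ e) =
    inj₂ (subst (_∈ keep E F) e (∈ₚ.∈-map⁺ (lookup E) (∈-elements⁺ F j (f j pj))))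

  walk⇒via : ∀ (F : Subset m) {p : EdgePred} → (∀ j → F ∋ j → p j) →
    ∀ {u v} → Walk (keep E F) u v → WalkVia p u v
  walk⇒via F f w = walk-map (keep⇒step F f) (walk⇒rwalk w)

  via⇒walk : ∀ (F : Subset m) {p : EdgePred} → (∀ j → p j → F ∋ j) →
    ∀ {u v} → WalkVia p u v → Walk (keep E F) u v
  via⇒walk F f w = rwalk⇒walk (walk-map (step⇒keep F f) w)

  all-edges : ∀ j → Vec.replicate m inside ∋ j
  all-edges j = Vecₚ.lookup-replicate j true

  step⇒adj : ∀ {p a b} → Step p a b → Adj (allEdges E) a b
  step⇒adj (j , _ , e) = step⇒keep (Vec.replicate m inside) (λ j _ → all-edges j) (j , tt , e)

  adj⇒step : ∀ {a b} → Adj (allEdges E) a b → Step AnyEdge a b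
  adj⇒step = keep⇒step (Vec.replicate m inside) (λ _ _ → tt)

  connected-via : ∀ u v → WalkVia AnyEdge u v
  connected-via u v = walk⇒via (Vec.replicate m inside) (λ _ _ → tt) (connected u v)

  path-between : ∀ u v → Σ (List (Fin n)) λ l → PathVia AnyEdge u v l × Unique l
  path-between u v = shortcut (connected-via u v)

  -- Removing the edge g = xy disconnects x from y: otherwise a path from x to
  -- y in T ∖ g closes up with g to a cycle.
  cut-separates : ∀ {g x y} → Joins g x y → ¬ WalkVia (Avoid g) x y
  cut-separates {g} {x} {y} e w with shortcut w
  ... | l , pc , u = no-path pc u
    where
    close : Adj (allEdges E) y x
    close = step⇒adj {p = AnyEdge} (g , tt , joins-sym e)
    cycle : ∀ {l} → PathVia (Avoid g) x y (x ∷ l) → Unique (x ∷ l) → 2 ≤ length l → ⊥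
    cycle pc u len = acyclic x _ (len , u , path⇒linked (path-snoc (path-map step⇒adj pc) close))
    no-path : ∀ {l} → PathVia (Avoid g) x y l → Unique l → ⊥
    no-path pnil _ = joins-distinct e refl
    no-path (pcons (j , j≢g , e') pnil) _ = j≢g (joins-unique e' e)
    no-path pc@(pcons s (pcons s' pnil)) u = cycle pc u (s≤s (s≤s z≤n))
    no-path pc@(pcons s (pcons s' (pcons s'' r))) u = cycle pc u (s≤s (s≤s z≤n))

  two-sides : ∀ {g x y} → Joins g x y → ∀ z → WalkVia (Avoid g) x z ⊎ WalkVia (Avoid g) y z
  two-sides {g} {x} {y} e z = go (connected-via x z) (inj₁ wnil)
    where
    go : ∀ {a z} → WalkVia AnyEdge a z →
      WalkVia (Avoid g) x a ⊎ WalkVia (Avoid g) y a → WalkVia (Avoid g) x z ⊎ WalkVia (Avoid g) y z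
    go wnil h = h
    go (wcons (j , _ , e') rest) h with j ≟ᶠ g
    ... | yes refl with joins-endpoint e (joins-sym e')
    ...   | inj₁ refl = go rest (inj₁ wnil)
    ...   | inj₂ refl = go rest (inj₂ wnil)
    go (wcons (j , _ , e') rest) (inj₁ h) | no j≢g = go rest (inj₁ (h ⊙ edge-walk j≢g e'))
    go (wcons (j , _ , e') rest) (inj₂ h) | no j≢g = go rest (inj₂ (h ⊙ edge-walk j≢g e'))

  avoid-end : ∀ {p g c d w v l} → Joins g c d → PathVia p w v l → c ∉ l → PathVia (p ∩ₑ Avoid g) w v l
  avoid-end e pnil c∉ = pnil
  avoid-end {g = g} e (pcons (j , pj , e') rest) c∉ with j ≟ᶠ g
  ... | yes refl with joins-endpoint e' e | path-head rest
  ...   | inj₁ refl | _         = ⊥-elim (c∉ (here refl))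
  ...   | inj₂ refl | t , refl = ⊥-elim (c∉ (there (here refl)))
  avoid-end e (pcons (j , pj , e') rest) c∉ | no j≢g =
    pcons (j , (pj , j≢g) , e') (avoid-end e rest (c∉ ∘ there))

  path-crosses : ∀ {p u v l} → PathVia p u v l → Unique l → ∀ g →
    PathVia (p ∩ₑ Avoid g) u v l ⊎
    (Σ (Fin n) λ x → Σ (Fin n) λ y → Joins g x y × WalkVia (p ∩ₑ Avoid g) u x × WalkVia (p ∩ₑ Avoid g) y v)
  path-crosses pnil un g = inj₁ pnil
  path-crosses (pcons {u = u} {w = w} (j , pj , e') rest) un g with j ≟ᶠ g
  ... | yes refl = inj₂ (u , w , e' , wnil , path⇒walk (avoid-end e' rest (unique-head un)))
  ... | no j≢g with path-crosses rest (unique-tail un) g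
  ...   | inj₁ p' = inj₁ (pcons (j , (pj , j≢g) , e') p')
  ...   | inj₂ (x , y , e , a , b) = inj₂ (x , y , e , wcons (j , (pj , j≢g) , e') a , b)

  path-avoids : ∀ {p u v l} → PathVia p u v l → Unique l → ∀ g → WalkVia (Avoid g) u v →
    PathVia (p ∩ₑ Avoid g) u v l
  path-avoids pc un g w with path-crosses pc un g
  ... | inj₁ p' = p'
  ... | inj₂ (x , y , e , a , b) =
    ⊥-elim (cut-separates e (via-sym (via-weaken a) ⊙ w ⊙ via-sym (via-weaken b)))

  via-transfer : ∀ {p q : EdgePred} {r z} → WalkVia p r z →
    (∀ j a b → p j → Joins j a b → WalkVia p r a → q j) → WalkVia q r z
  via-transfer {p} {q} {r} w h = go wnil w
    where
    go : ∀ {a z} → WalkVia p r a → WalkVia p a z → WalkVia q a z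
    go pre wnil = wnil
    go pre (wcons (j , pj , e) rest) = wcons (j , h j _ _ pj e pre , e) (go (pre ⊙ edge-walk pj e) rest)

  avoid-unreachable : ∀ {g h a b r} → Joins h a b → ¬ WalkVia (Avoid g) r a → ¬ WalkVia (Avoid g) r b →
    ∀ {z} → WalkVia (Avoid g) r z → WalkVia (Avoid h) r z
  avoid-unreachable {g} {h} {a} {b} {r} eh na nb w =
    via-transfer w λ h' a' b' _ e pre → λ { refl → unreachable e pre }
    where
    unreachable : ∀ {a' b'} → Joins h a' b' → WalkVia (Avoid g) r a' → ⊥
    unreachable e pre with joins-endpoint eh e
    ... | inj₁ refl = na pre
    ... | inj₂ refl = nb pre

  first-edge : ∀ {p z v l} → PathVia p z v l → Fin m → Fin m
  first-edge pnil                  d = d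
  first-edge (pcons (j , _) _) d = j

  first-edge-joins : ∀ {p z v l} (pc : PathVia p z v l) d → z ≢ v →
    Σ (Fin n) λ w → Joins (first-edge pc d) z w
  first-edge-joins pnil                  d z≢v = ⊥-elim (z≢v refl)
  first-edge-joins (pcons (j , _ , e) _) d z≢v = _ , e

  first-edge-separates : ∀ {p z v l} (pc : PathVia p z v l) d → Unique l → z ≢ v →
    ¬ WalkVia (Avoid (first-edge pc d)) z v
  first-edge-separates pnil d un z≢v w = z≢v refl
  first-edge-separates (pcons (j , pj , e) rest) d un z≢v w =
    cut-separates e (w ⊙ via-sym (via-weaken (path⇒walk (avoid-end e rest (unique-head un)))))

  first-edge-unique : ∀ {p z v l h w'} (pc : PathVia p z v l) d → Unique l → Joins h z w' →
    ¬ WalkVia (Avoid h) z v → first-edge pc d ≡ h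
  first-edge-unique pnil d un eh ns = ⊥-elim (ns wnil)
  first-edge-unique {h = h} (pcons (j , pj , e) rest) d un eh ns with j ≟ᶠ h
  ... | yes eq = eq
  ... | no j≢h =
    ⊥-elim (ns (edge-walk j≢h e ⊙ via-weaken (path⇒walk (avoid-end eh rest (unique-head un)))))

-- For g = xy every vertex lies on exactly one of the sides of x and
-- y, so θ_T(g) consists of their two sizes.

module Sides {n m : ℕ} (E : Edges n m) (tree : IsTree E) where

  open Tree E tree
  open Components {n}

  minus : Fin m → List (Fin n × Fin n)
  minus g = keep E (∁ ⁅ g ⁆)

  Side : Fin m → Fin n → Subset n
  Side g z = comp (minus g) z

  walk⇒avoid : ∀ g {u v} → Walk (minus g) u v → WalkVia (Avoid g) u v
  walk⇒avoid g = walk⇒via (∁ ⁅ g ⁆) (∋-∁⁅⁆ g)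

  avoid⇒walk : ∀ g {u v} → WalkVia (Avoid g) u v → Walk (minus g) u v
  avoid⇒walk g = via⇒walk (∁ ⁅ g ⁆) (∁⁅⁆-∋ g)

  side⇒avoid : ∀ g z x → Side g z ∋ x → WalkVia (Avoid g) z x
  side⇒avoid g z x c = walk⇒avoid g (comp-sound (minus g) z x c)

  avoid⇒side : ∀ g z x → WalkVia (Avoid g) z x → Side g z ∋ x
  avoid⇒side g z x w = comp-complete (minus g) z x (avoid⇒walk g w)

  side-nonempty : ∀ g z → 1 ≤ ∣ Side g z ∣
  side-nonempty g z = card-nonempty (Side g z) z (comp-self (minus g) z)

  θ-edge : ∀ g → θ E ⁅ g ⁆ ≡ sortDesc (∣ Side g (end₁ g) ∣ ∷ ∣ Side g (end₂ g) ∣ ∷ [])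
  θ-edge g = sortDesc-cong (compSizes-↭ (minus g) (end₁ g ∷ end₂ g ∷ [])
    (λ z → cover (two-sides (joins-ends g) z))
    (((λ w → cut-separates (joins-ends g) (walk⇒avoid g w)) ∷ []) ∷ ([] ∷ [])))
    where
    cover : ∀ {z} → WalkVia (Avoid g) (end₁ g) z ⊎ WalkVia (Avoid g) (end₂ g) z →
      ∃ λ r → r ∈ end₁ g ∷ end₂ g ∷ [] × Walk (minus g) r z
    cover (inj₁ w) = _ , here refl , avoid⇒walk g w
    cover (inj₂ w) = _ , there (here refl) , avoid⇒walk g w

  first second : List ℕ → ℕ
  first (a ∷ _) = a
  first []      = 0
  second (_ ∷ b ∷ _) = b
  second _           = 0

  record Cut (g : Fin m) (s : ℕ) : Set where
    field
      big small  : Fin n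
      joins      : Joins g big small
      small-size : ∣ Side g small ∣ ≡ s
      big-size   : ∣ Side g big ∣ ≡ n ∸ s
      small≤big  : s ≤ n ∸ s

  cut : ∀ g s → θ E ⁅ g ⁆ ≡ (n ∸ s) ∷ s ∷ [] → Cut g s
  cut g s h with b≡true⊎b≡false (∣ Side g (end₂ g) ∣ ≤ᵇ ∣ Side g (end₁ g) ∣)
  ... | inj₁ b = record
    { big = end₁ g ; small = end₂ g ; joins = joins-ends g
    ; small-size = cong second sorted ; big-size = cong first sorted
    ; small≤big = subst₂ _≤_ (cong second sorted) (cong first sorted) (≤ᵇ-true⇒≤ _ _ b) }
    where
    sorted : ∣ Side g (end₁ g) ∣ ∷ ∣ Side g (end₂ g) ∣ ∷ [] ≡ (n ∸ s) ∷ s ∷ []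
    sorted = trans (sym (if-true b)) (trans (sym (θ-edge g)) h)
  ... | inj₂ b = record
    { big = end₂ g ; small = end₁ g ; joins = joins-sym (joins-ends g)
    ; small-size = cong second sorted ; big-size = cong first sorted
    ; small≤big = subst₂ _≤_ (cong second sorted) (cong first sorted) (ℕₚ.<⇒≤ (≤ᵇ-false⇒> _ _ b)) }
    where
    sorted : ∣ Side g (end₂ g) ∣ ∷ ∣ Side g (end₁ g) ∣ ∷ [] ≡ (n ∸ s) ∷ s ∷ []
    sorted = trans (sym (if-false b)) (trans (sym (θ-edge g)) h)

-- For an edge j = vu at v, the branch of T at v
-- through j consists of j and the edges on u's side of T ∖ j; it is a subtree
-- with v as a leaf and ∣ Side j u ∣ edges, and every subtree with v as a leaf
-- lies in a single branch.  Hence the weight of v is the largest side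
-- ∣ Side j u ∣ over the edges j at v (weight-isWeight).

module Weights {n m : ℕ} (E : Edges n m) (tree : IsTree E) where

  open Tree E tree
  open Sides E tree
  import Data.List.Extrema ℕₚ.≤-totalOrder as Extrema

  incident : Fin n → Fin m → Bool
  incident v j = endpoint v (lookup E j)

  -- the end of j other than v (when v is an end of j)
  across : Fin m → Fin n → Fin n
  across j v with v ≟ᶠ end₁ j
  ... | yes _ = end₂ j
  ... | no _  = end₁ j

  incident⇒joins : ∀ v j → incident v j ≡ true → Joins j v (across j v)
  incident⇒joins v j p with v ≟ᶠ end₁ j | v ≟ᶠ end₂ j
  ... | yes refl | _        = inj₁ refl
  ... | no _     | yes refl = inj₂ refl

  joins⇒incident : ∀ {v j w} → Joins j v w → incident v j ≡ true × across j v ≡ w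
  joins⇒incident {v} {j} {w} e with v ≟ᶠ end₁ j | v ≟ᶠ end₂ j | joins-cases e
  ... | yes _  | _      | inj₁ (_ , w≡) = refl , sym w≡
  ... | yes v≡ | _      | inj₂ (v≡' , _) = ⊥-elim (joins-distinct (joins-ends j) (trans (sym v≡) v≡'))
  ... | no v≢  | _      | inj₁ (v≡ , _) = ⊥-elim (v≢ v≡)
  ... | no _   | yes _  | inj₂ (_ , w≡) = refl , sym w≡
  ... | no _   | no v≢  | inj₂ (v≡ , _) = ⊥-elim (v≢ v≡)

  incident⇒endpoint : ∀ v j → incident v j ≡ true → v ≡ end₁ j ⊎ v ≡ end₂ j
  incident⇒endpoint v j p with joins-cases (incident⇒joins v j p)
  ... | inj₁ (a , _) = inj₁ a
  ... | inj₂ (a , _) = inj₂ a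

  -- the number of edges of the branch at v through j
  branch : Fin n → Fin m → ℕ
  branch v j = ∣ Side j (across j v) ∣

  incidentEdges : Fin n → List (Fin m)
  incidentEdges v = filterᵇ (incident v) (allFin m)

  ∈-incidentEdges⁺ : ∀ v j → incident v j ≡ true → j ∈ incidentEdges v
  ∈-incidentEdges⁺ v j p = ∈ₚ.∈-filter⁺ (T? ∘ incident v) (∈ₚ.∈-allFin j) (≡true⇒T p)

  ∈-incidentEdges⁻ : ∀ v j → j ∈ incidentEdges v → incident v j ≡ true
  ∈-incidentEdges⁻ v j j∈ = T⇒≡true (proj₂ (∈ₚ.∈-filter⁻ (T? ∘ incident v) {xs = allFin m} j∈))

  weight : Fin n → ℕ
  weight v = Extrema.max 0 (map (branch v) (incidentEdges v))

  branch≤weight : ∀ v j → incident v j ≡ true → branch v j ≤ weight v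
  branch≤weight v j p =
    All.lookup (Extrema.xs≤max 0 _) (∈ₚ.∈-map⁺ (branch v) (∈-incidentEdges⁺ v j p))

  weight≤ : ∀ v B → (∀ j → incident v j ≡ true → branch v j ≤ B) → weight v ≤ B
  weight≤ v B h = Extrema.max≤v⁺ z≤n (All.tabulate λ {b} b∈ →
    let (j , j∈ , b≡) = ∈ₚ.∈-map⁻ (branch v) b∈ in
    subst (_≤ B) (sym b≡) (h j (∈-incidentEdges⁻ v j j∈)))

  weight-attained : ∀ v j₀ → incident v j₀ ≡ true →
    Σ (Fin m) λ j → incident v j ≡ true × branch v j ≡ weight v
  weight-attained v j₀ p with Extrema.argmax-sel id 0 (map (branch v) (incidentEdges v))
  ... | inj₂ w∈ = let (j , j∈ , w≡) = ∈ₚ.∈-map⁻ (branch v) w∈ in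
                  j , ∈-incidentEdges⁻ v j j∈ , sym w≡
  ... | inj₁ w≡0 = ⊥-elim (ℕₚ.<-irrefl refl (ℕₚ.<-≤-trans (side-nonempty j₀ (across j₀ v))
                     (subst (branch v j₀ ≤_) w≡0 (branch≤weight v j₀ p))))

  AtV : Subset m → Fin n → Fin m → Bool
  AtV F v h = lookup F h ∧ incident v h

  degree-one : ∀ (F : Subset m) v j → (∀ h → AtV F v h ≡ true → h ≡ j) → AtV F v j ≡ true →
    degIn E F v ≡ 1
  degree-one F v j unique-j Fj = ↭ₚ.↭-length {xs = filterᵇ (AtV F v) (allFin m)} {ys = j ∷ []}
    (unique-same-elements⇒↭ (Uniqueₚ.filter⁺ (T? ∘ AtV F v) (Uniqueₚ.allFin⁺ m)) (unique-∷ (λ ()) [])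
      (λ z∈ → here (unique-j _ (T⇒≡true (proj₂ (∈ₚ.∈-filter⁻ (T? ∘ AtV F v) {xs = allFin m} z∈)))))
      (λ { (here refl) → ∈ₚ.∈-filter⁺ (T? ∘ AtV F v) (∈ₚ.∈-allFin j) (≡true⇒T Fj) }))

  degree-one⁻ : ∀ (F : Subset m) v → degIn E F v ≡ 1 →
    Σ (Fin m) λ j → AtV F v j ≡ true × (∀ h → AtV F v h ≡ true → h ≡ j)
  degree-one⁻ F v d with filterᵇ (AtV F v) (allFin m) in eq | d
  ... | j ∷ [] | _ =
      j , T⇒≡true (proj₂ (∈ₚ.∈-filter⁻ (T? ∘ AtV F v) {xs = allFin m} (subst (j ∈_) (sym eq) (here refl))))
    , λ h p → singleton (subst (h ∈_) eq (∈ₚ.∈-filter⁺ (T? ∘ AtV F v) (∈ₚ.∈-allFin h) (≡true⇒T p)))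
    where
    singleton : ∀ {h} → h ∈ j ∷ [] → h ≡ j
    singleton (here e) = e

  module Branch (v : Fin n) (j : Fin m) (incj : incident v j ≡ true) where

    u : Fin n
    u = across j v

    vu : Joins j v u
    vu = incident⇒joins v j incj

    v∉side : ¬ Side j u ∋ v
    v∉side c = cut-separates (joins-sym vu) (side⇒avoid j u v c)

    edges : Subset m
    edges = Vec.tabulate (λ h → does (h ≟ᶠ j) ∨ lookup (Side j u) (end₁ h))

    ∋-edges⁻ : ∀ h → edges ∋ h → h ≡ j ⊎ Side j u ∋ end₁ h
    ∋-edges⁻ h p with ∨-elim _ _ (trans (sym (Vecₚ.lookup∘tabulate _ h)) p)
    ... | inj₁ q = inj₁ (does⇒≡ (h ≟ᶠ j) q)
      where
      does⇒≡ : (d : Dec (h ≡ j)) → does d ≡ true → h ≡ j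
      does⇒≡ (yes h≡j) _ = h≡j
    ... | inj₂ q = inj₂ q

    ∋-edges⁺ : ∀ h → h ≡ j ⊎ Side j u ∋ end₁ h → edges ∋ h
    ∋-edges⁺ h (inj₁ refl) = trans (Vecₚ.lookup∘tabulate _ h) (∨-introˡ _ (does-refl (h ≟ᶠ h)))
      where
      does-refl : (d : Dec (h ≡ h)) → does d ≡ true
      does-refl (yes _)  = refl
      does-refl (no h≢h) = ⊥-elim (h≢h refl)
    ∋-edges⁺ h (inj₂ q) = trans (Vecₚ.lookup∘tabulate _ h) (∨-introʳ _ q)

    side-closed : ∀ h x → h ≢ j → Side j u ∋ end₁ h → x ≡ end₁ h ⊎ x ≡ end₂ h → Side j u ∋ x
    side-closed h x h≢j c (inj₁ refl) = c
    side-closed h x h≢j c (inj₂ refl) =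
      avoid⇒side j u _ (side⇒avoid j u _ c ⊙ edge-walk h≢j (joins-ends h))

    only-edge-at-v : ∀ h → edges ∋ h → incident v h ≡ true → h ≡ j
    only-edge-at-v h p ih with ∋-edges⁻ h p | h ≟ᶠ j
    ... | inj₁ e | _       = e
    ... | inj₂ c | yes e   = e
    ... | inj₂ c | no h≢j = ⊥-elim (v∉side (side-closed h v h≢j c (incident⇒endpoint v h ih)))

    degree : degIn E edges v ≡ 1
    degree = degree-one edges v j
      (λ h p → let (a , b) = ∧-elim _ _ p in only-edge-at-v h a b)
      (∧-intro (∋-edges⁺ j (inj₁ refl)) incj)

    spanned-reachable : ∀ x → InSpan E edges x → WalkVia (edges ∋_) u x
    spanned-reachable x (h , h∈ , x-end) with h ≟ᶠ j
    ... | yes refl with joins-endpoint vu (proj₂ (endpoint-joins j x x-end))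
    ...   | inj₁ refl = edge-walk (∋-edges⁺ j (inj₁ refl)) (joins-sym vu)
    ...   | inj₂ refl = wnil
    spanned-reachable x (h , h∈ , x-end) | no h≢j with ∋-edges⁻ h (∈⇒∋ h∈)
    ... | inj₁ e = ⊥-elim (h≢j e)
    ... | inj₂ c = via-transfer (side⇒avoid j u x (side-closed h x h≢j c x-end))
          λ h' a b h'≢j e' pre → ∋-edges⁺ h' (inj₂ (first-end-in-side h' a b h'≢j e' pre))
      where
      first-end-in-side : ∀ h' a b → h' ≢ j → Joins h' a b → WalkVia (Avoid j) u a →
        Side j u ∋ end₁ h'
      first-end-in-side h' a b h'≢j e' pre with joins-cases e'
      ... | inj₁ (a≡ , _) = subst (Side j u ∋_) a≡ (avoid⇒side j u a pre)
      ... | inj₂ (_ , b≡) = subst (Side j u ∋_) b≡ (avoid⇒side j u b (pre ⊙ edge-walk h'≢j e'))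

    leafSubtree : LeafSubtree E v edges
    leafSubtree = degree , λ x y sx sy →
      via⇒walk edges (λ _ p → p) (via-sym (spanned-reachable x sx) ⊙ spanned-reachable y sy)

    -- each vertex z on u's side is the near end of the first edge of the
    -- path from z to v, which lies in the branch; this is injective.
    parent : Fin n → Fin m
    parent z = first-edge (proj₁ (proj₂ (path-between z v))) j

    branch≤size : branch v j ≤ ∣ edges ∣
    branch≤size = card-injection (Side j u) edges parent parent-∈ parent-injective
      where
      z≢v : ∀ z → Side j u ∋ z → z ≢ v
      z≢v z c refl = v∉side c
      parent-∈ : ∀ z → Side j u ∋ z → edges ∋ parent z
      parent-∈ z c with path-between z v
      ... | l , pc , un with first-edge-joins pc j (z≢v z c) | first-edge pc j ≟ᶠ j
      ... | w , e | yes eq    = ∋-edges⁺ _ (inj₁ eq)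
      ... | w , e | no p≢j with joins-cases e
      ...   | inj₁ (z≡ , _) = ∋-edges⁺ _ (inj₂ (subst (Side j u ∋_) z≡ c))
      ...   | inj₂ (_ , w≡) = ∋-edges⁺ _ (inj₂ (subst (Side j u ∋_) w≡
                                (avoid⇒side j u w (side⇒avoid j u z c ⊙ edge-walk p≢j e))))
      parent-spec : ∀ z → Side j u ∋ z →
        Σ (Fin n) (λ w → Joins (parent z) z w) × ¬ WalkVia (Avoid (parent z)) z v
      parent-spec z c with path-between z v
      ... | l , pc , un = first-edge-joins pc j (z≢v z c) , first-edge-separates pc j un (z≢v z c)
      parent-injective : ∀ z z' → Side j u ∋ z → Side j u ∋ z' → parent z ≡ parent z' → z ≡ z'
      parent-injective z z' c c' eq with parent-spec z c | parent-spec z' c'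
      ... | (w , e) , s | (w' , e') , s' with joins-endpoint e (subst (λ h → Joins h z' w') (sym eq) e')
      ...   | inj₁ r = sym r
      ...   | inj₂ refl with two-sides e v
      ...     | inj₁ q = ⊥-elim (s q)
      ...     | inj₂ q = ⊥-elim (s' (subst (λ h → WalkVia (Avoid h) z' v) eq q))

  -- Every subtree F with v as a leaf has a single edge at v, its stem, and
  -- has at most as many edges as the branch through the stem: the far end
  -- of each edge of F lies across the stem, injectively.
  module LeafBound (v : Fin n) (F : Subset m) (leaf : LeafSubtree E v F) where

    stem-data : Σ (Fin m) λ j → AtV F v j ≡ true × (∀ h → AtV F v h ≡ true → h ≡ j)
    stem-data = degree-one⁻ F v (proj₁ leaf)

    stem : Fin m
    stem = proj₁ stem-data

    stem-∈ : F ∋ stem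
    stem-∈ = proj₁ (∧-elim _ _ (proj₁ (proj₂ stem-data)))

    stem-incident : incident v stem ≡ true
    stem-incident = proj₂ (∧-elim _ _ (proj₁ (proj₂ stem-data)))

    stem-unique : ∀ h → F ∋ h → incident v h ≡ true → h ≡ stem
    stem-unique h Fh ih = proj₂ (proj₂ stem-data) h (∧-intro Fh ih)

    u : Fin n
    u = across stem v

    vu : Joins stem v u
    vu = incident⇒joins v stem stem-incident

    far-end : Fin m → Fin n
    far-end h = if lookup (Side h v) (end₁ h) then end₂ h else end₁ h

    far-end-is-end : ∀ h → far-end h ≡ end₁ h ⊎ far-end h ≡ end₂ h
    far-end-is-end h with lookup (Side h v) (end₁ h)
    ... | true  = inj₂ refl
    ... | false = inj₁ refl

    far-end-separated : ∀ h → ¬ WalkVia (Avoid h) v (far-end h)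
    far-end-separated h with lookup (Side h v) (end₁ h) in eq
    ... | true  = λ w → cut-separates (joins-ends h) (via-sym (side⇒avoid h v _ eq) ⊙ w)
    ... | false = λ w → case (trans (sym eq) (avoid⇒side h v _ w))
      where
      case : false ≡ true → ⊥
      case ()

    spanned-across : ∀ x → InSpan E F x → x ≢ v → WalkVia (Avoid stem) u x
    spanned-across x sx x≢v
      with shortcut (walk⇒via F (λ _ p → p) (proj₂ leaf u x (stem , ∋⇒∈ {X = F} stem-∈ , u-end) sx))
      where
      u-end : u ≡ end₁ stem ⊎ u ≡ end₂ stem
      u-end with joins-cases vu
      ... | inj₁ (_ , b) = inj₂ b
      ... | inj₂ (_ , b) = inj₁ b
    ... | l , pc , un with path-crosses pc un stem
    ...   | inj₁ p' = via-weaken (path⇒walk p')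
    ...   | inj₂ (x₁ , y₁ , e , a , b) with joins-endpoint vu (joins-sym e)
    ...     | inj₂ refl = via-weaken b
    ...     | inj₁ refl with b
    ...       | wnil = ⊥-elim (x≢v refl)
    ...       | wcons (h' , (Fh' , h'≢stem) , e') _ =
                  ⊥-elim (h'≢stem (stem-unique h' Fh' (proj₁ (joins⇒incident e'))))

    far-end-across : ∀ h → F ∋ h → Side stem u ∋ far-end h
    far-end-across h Fh = avoid⇒side stem u _ (spanned-across (far-end h)
      (h , ∋⇒∈ {X = F} Fh , far-end-is-end h)
      λ e → far-end-separated h (subst (WalkVia (Avoid h) v) (sym e) wnil))

    far-end-injective : ∀ h h' → F ∋ h → F ∋ h' → far-end h ≡ far-end h' → h ≡ h'
    far-end-injective h h' _ _ eq with path-between (far-end h) v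
    ... | l , pc , un =
      trans (sym (first-edge-unique pc stem un (proj₂ (endpoint-joins h _ (far-end-is-end h)))
                   λ w → far-end-separated h (via-sym w)))
            (first-edge-unique pc stem un
              (proj₂ (endpoint-joins h' _ (subst (λ z → z ≡ end₁ h' ⊎ z ≡ end₂ h') (sym eq) (far-end-is-end h'))))
              λ w → far-end-separated h' (via-sym (subst (λ z → WalkVia (Avoid h') z v) eq w)))

    size≤branch : ∣ F ∣ ≤ branch v stem
    size≤branch = card-injection F (Side stem u) far-end far-end-across far-end-injective

  branch-size : ∀ v j (incj : incident v j ≡ true) → ∣ Branch.edges v j incj ∣ ≡ branch v j
  branch-size v j incj = ℕₚ.≤-antisym
    (subst (λ h → ∣ Branch.edges v j incj ∣ ≤ branch v h) stem≡j LB.size≤branch)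
    (Branch.branch≤size v j incj)
    where
    module LB = LeafBound v (Branch.edges v j incj) (Branch.leafSubtree v j incj)
    stem≡j : LB.stem ≡ j
    stem≡j = Branch.only-edge-at-v v j incj LB.stem LB.stem-∈ LB.stem-incident

  weight-isWeight : ∀ v j₀ → incident v j₀ ≡ true → IsWeight E v (weight v)
  weight-isWeight v j₀ p with weight-attained v j₀ p
  ... | j , incj , eq =
      (Branch.edges v j incj , Branch.leafSubtree v j incj , trans (branch-size v j incj) eq)
    , λ F leaf → let module LB = LeafBound v F leaf in
                 ℕₚ.≤-trans LB.size≤branch (branch≤weight v LB.stem LB.stem-incident)

-- Centroids, in a tree having some edge g₀ (so that every vertex has an
-- incident edge).

module Centroids {n m : ℕ} (E : Edges n m) (tree : IsTree E) (g₀ : Fin m) where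

  open Tree E tree
  open Sides E tree
  open Weights E tree
  open Components {n}
  import Data.List.Extrema ℕₚ.≤-totalOrder as Extrema

  incident-towards : ∀ v t → v ≢ t → Σ (Fin m) λ j → incident v j ≡ true
  incident-towards v t v≢t =
    let (l , pc , _) = path-between v t
        (w , e) = first-edge-joins pc g₀ v≢t
    in _ , proj₁ (joins⇒incident e)

  incident-edge : ∀ v → Σ (Fin m) λ j → incident v j ≡ true
  incident-edge v with v ≟ᶠ end₁ g₀
  ... | yes v≡ = incident-towards v (end₂ g₀) λ q → joins-distinct (joins-ends g₀) (trans (sym v≡) q)
  ... | no v≢  = incident-towards v (end₁ g₀) v≢

  isWeight : ∀ v → IsWeight E v (weight v)
  isWeight v = weight-isWeight v (proj₁ (incident-edge v)) (proj₂ (incident-edge v))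

  weight≤isWeight : ∀ v w → IsWeight E v w → weight v ≤ w
  weight≤isWeight v w (_ , largest) =
    let ((F , leaf , size) , _) = isWeight v in subst (_≤ w) size (largest F leaf)

  branch≤isWeight : ∀ v w j → IsWeight E v w → incident v j ≡ true → branch v j ≤ w
  branch≤isWeight v w j (_ , largest) incj =
    subst (_≤ w) (branch-size v j incj) (largest (Branch.edges v j incj) (Branch.leafSubtree v j incj))

  -- A vertex v on x's side of g = xy has a branch containing all of y's side.
  side≤weight : ∀ {g x y v w} → Joins g x y → WalkVia (Avoid g) x v → IsWeight E v w →
    ∣ Side g y ∣ ≤ w
  side≤weight {g} {x} {y} {v} {w} e xv iw with path-between v y
  ... | l , pc , un = via-first-edge pc un
    where
    v≢y : v ≢ y
    v≢y refl = cut-separates e xv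
    via-first-edge : ∀ {l} → PathVia AnyEdge v y l → Unique l → ∣ Side g y ∣ ≤ w
    via-first-edge pnil un = ⊥-elim (v≢y refl)
    via-first-edge (pcons {w = w₀} (j₀ , _ , e₀) rest) un =
      ℕₚ.≤-trans (card-mono (Side g y) (Side j₀ (across j₀ v)) inside-branch)
                 (branch≤isWeight v w j₀ iw (proj₁ (joins⇒incident e₀)))
      where
      w₀y : WalkVia (Avoid j₀) w₀ y
      w₀y = via-weaken (path⇒walk (avoid-end e₀ rest (unique-head un)))
      j₀-not-beyond : ∀ a b → Joins j₀ a b → j₀ ≢ g → WalkVia (Avoid g) y a → ⊥
      j₀-not-beyond a b eh j₀≢g pre with joins-endpoint eh e₀
      ... | inj₁ refl = cut-separates e (xv ⊙ via-sym pre)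
      ... | inj₂ refl = cut-separates e (xv ⊙ via-sym (pre ⊙ edge-walk j₀≢g eh))
      inside-branch : ∀ z → Side g y ∋ z → Side j₀ (across j₀ v) ∋ z
      inside-branch z c = subst (λ q → Side j₀ q ∋ z) (sym (proj₂ (joins⇒incident e₀)))
        (avoid⇒side j₀ w₀ z (w₀y ⊙ via-transfer (side⇒avoid g y z c)
          λ h a b h≢g eh pre → λ { refl → j₀-not-beyond a b eh h≢g pre }))

  -- Each branch at y other than through g lies strictly inside y's side.
  weight-bound : ∀ {g x y} → Joins g x y → ∀ B → ∣ Side g x ∣ ≤ B → ∣ Side g y ∣ ≤ suc B →
    weight y ≤ B
  weight-bound {g} {x} {y} e B x≤B y≤B+1 = weight≤ y B bound
    where
    bound : ∀ j → incident y j ≡ true → branch y j ≤ B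
    bound j incj with j ≟ᶠ g
    ... | yes refl = subst (λ q → ∣ Side j q ∣ ≤ B) (joins-other (joins-sym e) (incident⇒joins y j incj)) x≤B
    ... | no j≢g = ℕₚ.≤-pred (ℕₚ.≤-trans (card-strict (Side j u) (Side g y) contained y
                     (comp-self (minus g) y) y∉) y≤B+1)
      where
      u : Fin n
      u = across j y
      yu : Joins j y u
      yu = incident⇒joins y j incj
      y∉ : ¬ Side j u ∋ y
      y∉ c = cut-separates yu (via-sym (side⇒avoid j u y c))
      g-not-beyond : ∀ a b → Joins g a b → g ≢ j → WalkVia (Avoid j) u a → ⊥
      g-not-beyond a b eh g≢j pre with joins-endpoint eh (joins-sym e)
      ... | inj₁ refl = y∉ (avoid⇒side j u y pre)
      ... | inj₂ refl = y∉ (avoid⇒side j u y (pre ⊙ edge-walk g≢j eh))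
      contained : ∀ z → Side j u ∋ z → Side g y ∋ z
      contained z c = avoid⇒side g y z (edge-walk j≢g yu ⊙ via-transfer (side⇒avoid j u z c)
        λ h a b h≢j eh pre → λ { refl → g-not-beyond a b eh h≢j pre })

  -- A centroid c on x's side of g = xy: were y's side larger, y would weigh less than c.
  centroid-side : ∀ {c g x y} → Centroid E c → Joins g x y → WalkVia (Avoid g) x c →
    ∣ Side g y ∣ ≤ ∣ Side g x ∣
  centroid-side {c} {g} {x} {y} (w , iw , minimal) e xc =
    ℕₚ.≮⇒≥ λ x<y → larger (∣ Side g y ∣) refl x<y
    where
    larger : ∀ s → ∣ Side g y ∣ ≡ s → ∣ Side g x ∣ < s → ⊥
    larger (suc s') eq x<y =
      ℕₚ.<-irrefl refl (ℕₚ.≤-trans (subst (_≤ w) eq (side≤weight e xc iw))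
        (ℕₚ.≤-trans (minimal y (weight y) (isWeight y))
          (weight-bound e s' (ℕₚ.≤-pred x<y) (ℕₚ.≤-reflexive eq))))

  balanced⇒centroid : ∀ {g x y} → Joins g x y → ∣ Side g x ∣ ≡ ∣ Side g y ∣ → Centroid E x
  balanced⇒centroid {g} {x} {y} e eq =
    weight x , isWeight x , λ v w' iw → ℕₚ.≤-trans weight-x (lower v w' iw)
    where
    weight-x : weight x ≤ ∣ Side g y ∣
    weight-x = weight-bound (joins-sym e) ∣ Side g y ∣ ℕₚ.≤-refl
      (ℕₚ.≤-trans (ℕₚ.≤-reflexive eq) (ℕₚ.n≤1+n _))
    lower : ∀ v w' → IsWeight E v w' → ∣ Side g y ∣ ≤ w'
    lower v w' iw with two-sides e v
    ... | inj₁ q = side≤weight e q iw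
    ... | inj₂ q = subst (_≤ w') eq (side≤weight (joins-sym e) q iw)

  centroid-exists : Σ (Fin n) (Centroid E)
  centroid-exists = c , weight c , isWeight c , λ v w' iw →
    ℕₚ.≤-trans (All.lookup (Extrema.f[argmin]≤f[xs] (end₁ g₀) (allFin n)) (∈ₚ.∈-allFin v))
               (weight≤isWeight v w' iw)
    where
    c : Fin n
    c = Extrema.argmin weight (end₁ g₀) (allFin n)

-- Writing A
-- and B for the small sides, either B ⊆ A and eb lies in A (nested), or A and
-- B are disjoint; a third configuration would put a whole side of ea strictly
-- inside B, contradicting k ≤ i ≤ n ∸ i.

module TwoEdges {n m : ℕ} (E : Edges n m) (tree : IsTree E) (ea eb : Fin m) where

  open Tree E tree
  open Sides E tree
  open Components {n}

  minus₂ : List (Fin n × Fin n)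
  minus₂ = keep E (∁ (⁅ ea ⁆ ∪ ⁅ eb ⁆))

  AvoidBoth : EdgePred
  AvoidBoth = Avoid ea ∩ₑ Avoid eb

  walk⇒avoidBoth : ∀ {u v} → Walk minus₂ u v → WalkVia AvoidBoth u v
  walk⇒avoidBoth = walk⇒via (∁ (⁅ ea ⁆ ∪ ⁅ eb ⁆)) (∋-∁⁅⁆∪⁅⁆ ea eb)

  avoidBoth⇒walk : ∀ {u v} → WalkVia AvoidBoth u v → Walk minus₂ u v
  avoidBoth⇒walk = via⇒walk (∁ (⁅ ea ⁆ ∪ ⁅ eb ⁆)) λ j p → ∁⁅⁆∪⁅⁆-∋ ea eb j (proj₁ p) (proj₂ p)

  avoid-both : ∀ {u v} → WalkVia (Avoid ea) u v → WalkVia (Avoid eb) u v → WalkVia AvoidBoth u v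
  avoid-both wa wb with shortcut wa
  ... | l , pc , un = path⇒walk (path-avoids pc un eb wb)

  Part : Fin n → Subset n
  Part r = comp minus₂ r

  part⇒avoidBoth : ∀ r z → Part r ∋ z → WalkVia AvoidBoth r z
  part⇒avoidBoth r z c = walk⇒avoidBoth (comp-sound minus₂ r z c)

  avoidBoth⇒part : ∀ r z → WalkVia AvoidBoth r z → Part r ∋ z
  avoidBoth⇒part r z w = comp-complete minus₂ r z (avoidBoth⇒walk w)

  part-nonempty : ∀ r → 1 ≤ ∣ Part r ∣
  part-nonempty r = card-nonempty (Part r) r (comp-self minus₂ r)

  θ-three-parts : ∀ r₁ r₂ r₃ → (∀ z → WalkVia AvoidBoth r₁ z ⊎ WalkVia AvoidBoth r₂ z ⊎ WalkVia AvoidBoth r₃ z) →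
    ¬ WalkVia AvoidBoth r₁ r₂ → ¬ WalkVia AvoidBoth r₁ r₃ → ¬ WalkVia AvoidBoth r₂ r₃ →
    θ E (⁅ ea ⁆ ∪ ⁅ eb ⁆) ≡ sortDesc (∣ Part r₁ ∣ ∷ ∣ Part r₂ ∣ ∷ ∣ Part r₃ ∣ ∷ [])
  θ-three-parts r₁ r₂ r₃ cover s₁₂ s₁₃ s₂₃ = sortDesc-cong (compSizes-↭ minus₂ (r₁ ∷ r₂ ∷ r₃ ∷ [])
    (λ z → reps (cover z))
    (((s₁₂ ∘ walk⇒avoidBoth) ∷ (s₁₃ ∘ walk⇒avoidBoth) ∷ []) ∷ (((s₂₃ ∘ walk⇒avoidBoth) ∷ []) ∷ ([] ∷ []))))
    where
    reps : ∀ {z} → WalkVia AvoidBoth r₁ z ⊎ WalkVia AvoidBoth r₂ z ⊎ WalkVia AvoidBoth r₃ z →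
      ∃ λ r → r ∈ r₁ ∷ r₂ ∷ r₃ ∷ [] × Walk minus₂ r z
    reps (inj₁ w)        = _ , here refl , avoidBoth⇒walk w
    reps (inj₂ (inj₁ w)) = _ , there (here refl) , avoidBoth⇒walk w
    reps (inj₂ (inj₂ w)) = _ , there (there (here refl)) , avoidBoth⇒walk w

  module Configuration (ea≢eb : ea ≢ eb) (i k : ℕ) (k≤i : k ≤ i)
    (θa : θ E ⁅ ea ⁆ ≡ (n ∸ i) ∷ i ∷ []) (θb : θ E ⁅ eb ⁆ ≡ (n ∸ k) ∷ k ∷ []) where

    open Cut (cut ea i θa) public using () renaming
      (big to xa; small to ya; joins to eA; small-size to |ya|; big-size to |xa|; small≤big to i≤n∸i)
    open Cut (cut eb k θb) public using () renaming
      (big to xb; small to yb; joins to eB; small-size to |yb|; big-size to |xb|)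

    A B : Fin n → Set
    A z = WalkVia (Avoid ea) ya z
    B z = WalkVia (Avoid eb) yb z

    A-disjoint : ∀ {z} → WalkVia (Avoid ea) xa z → ¬ A z
    A-disjoint p q = cut-separates eA (p ⊙ via-sym q)

    B-disjoint : ∀ {z} → WalkVia (Avoid eb) xb z → ¬ B z
    B-disjoint p q = cut-separates eB (p ⊙ via-sym q)

    not-A : ∀ {z} → ¬ A z → WalkVia (Avoid ea) xa z
    not-A {z} ¬Az with two-sides eA z
    ... | inj₁ w = w
    ... | inj₂ w = ⊥-elim (¬Az w)

    not-B : ∀ {z} → ¬ B z → WalkVia (Avoid eb) xb z
    not-B {z} ¬Bz with two-sides eB z
    ... | inj₁ w = w
    ... | inj₂ w = ⊥-elim (¬Bz w)

    eb-avoids-ea : WalkVia (Avoid ea) xb yb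
    eb-avoids-ea = edge-walk (λ e → ea≢eb (sym e)) eB

    ea-avoids-eb : WalkVia (Avoid eb) xa ya
    ea-avoids-eb = edge-walk ea≢eb eA

    side-inside-B : ∀ {r r'} → Joins ea r r' → B r → B r' →
      ¬ WalkVia (Avoid ea) r xb → ¬ WalkVia (Avoid ea) r yb → ∣ Side ea r ∣ < k
    side-inside-B {r} {r'} er Br Br' ¬xb ¬yb = subst (∣ Side ea r ∣ <_) |yb|
      (card-strict (Side ea r) (Side eb yb)
        (λ z c → avoid⇒side eb yb z (Br ⊙ avoid-unreachable eB ¬xb ¬yb (side⇒avoid ea r z c)))
        r' (avoid⇒side eb yb r' Br') (λ c → cut-separates er (side⇒avoid ea r r' c)))

    ya∉B : ¬ B ya
    ya∉B Bya with two-sides eA yb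
    ... | inj₂ Ayb = ℕₚ.<-irrefl refl (ℕₚ.<-≤-trans (subst (_< k) |xa| small)
                                         (ℕₚ.≤-trans k≤i i≤n∸i))
      where
      small : ∣ Side ea xa ∣ < k
      small = side-inside-B eA (Bya ⊙ via-sym ea-avoids-eb) Bya
        (λ q → A-disjoint q (Ayb ⊙ via-sym eb-avoids-ea)) (λ q → A-disjoint q Ayb)
    ... | inj₁ xa→yb = ℕₚ.<-irrefl refl (ℕₚ.<-≤-trans (subst (_< k) |ya| small) k≤i)
      where
      small : ∣ Side ea ya ∣ < k
      small = side-inside-B (joins-sym eA) Bya (Bya ⊙ via-sym ea-avoids-eb)
        (λ q → A-disjoint (xa→yb ⊙ via-sym eb-avoids-ea) q) (λ q → A-disjoint xa→yb q)

    xb→ya : WalkVia (Avoid eb) xb ya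
    xb→ya = not-B ya∉B

    xb→xa : WalkVia (Avoid eb) xb xa
    xb→xa = xb→ya ⊙ via-sym ea-avoids-eb

    xa∉B : ¬ B xa
    xa∉B = B-disjoint xb→xa

    -- neither end of ea is in B, so walks inside B avoid ea
    B-avoids-ea : ∀ z → B z → WalkVia (Avoid ea) yb z
    B-avoids-ea z = avoid-unreachable eA xa∉B (B-disjoint xb→ya)

    data Configuration : Set where
      nested   : (∀ z → B z → A z) → A xb → Configuration
      disjoint : (∀ z → A z → ¬ B z) → Configuration

    configuration : Configuration
    configuration with two-sides eA yb
    ... | inj₂ Ayb   = nested (λ z Bz → Ayb ⊙ B-avoids-ea z Bz) (Ayb ⊙ via-sym eb-avoids-ea)
    ... | inj₁ xa→yb = disjoint (λ z Az Bz → A-disjoint (xa→yb ⊙ B-avoids-ea z Bz) Az)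

    module Nested (B⊆A : ∀ z → B z → A z) (Axb : A xb) where

      size-yb : ∣ Part yb ∣ ≡ k
      size-yb = trans (card-cong (Part yb) (Side eb yb)
          (λ z c → avoid⇒side eb yb z (via-weaken (part⇒avoidBoth yb z c)))
          (λ z c → let Bz = side⇒avoid eb yb z c in
                   avoidBoth⇒part yb z (avoid-both (via-sym (B⊆A yb wnil) ⊙ B⊆A z Bz) Bz)))
        |yb|

      size-xa : ∣ Part xa ∣ ≡ n ∸ i
      size-xa = trans (card-cong (Part xa) (Side ea xa)
          (λ z c → avoid⇒side ea xa z (via-mono (λ _ → proj₁) (part⇒avoidBoth xa z c)))
          (λ z c → let xa→z = side⇒avoid ea xa z c in
                   avoidBoth⇒part xa z (avoid-both xa→z
                     (via-sym (not-B xa∉B) ⊙ not-B (λ Bz → A-disjoint xa→z (B⊆A z Bz))))))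
        |xa|

      -- A is the disjoint union of the parts of xb and yb
      size-xb : ∣ Part xb ∣ ≡ i ∸ k
      size-xb = trans (sym (ℕₚ.m+n∸n≡m ∣ Part xb ∣ k))
        (cong (_∸ k) (trans (cong (∣ Part xb ∣ +_) (sym size-yb))
          (trans (sym (card-disjoint-union (Part xb) (Part yb) (Side ea ya) split xb⊆A yb⊆A apart)) |ya|)))
        where
        split : ∀ z → Side ea ya ∋ z → Part xb ∋ z ⊎ Part yb ∋ z
        split z c with two-sides eB z
        ... | inj₂ Bz = inj₂ (avoidBoth⇒part yb z (avoid-both (via-sym (B⊆A yb wnil) ⊙ B⊆A z Bz) Bz))
        ... | inj₁ xb→z = inj₁ (avoidBoth⇒part xb z
                              (avoid-both (via-sym Axb ⊙ side⇒avoid ea ya z c) xb→z))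
        xb⊆A : ∀ z → Part xb ∋ z → Side ea ya ∋ z
        xb⊆A z c = avoid⇒side ea ya z (Axb ⊙ via-mono (λ _ → proj₁) (part⇒avoidBoth xb z c))
        yb⊆A : ∀ z → Part yb ∋ z → Side ea ya ∋ z
        yb⊆A z c = avoid⇒side ea ya z (B⊆A z (via-weaken (part⇒avoidBoth yb z c)))
        apart : ∀ z → Part xb ∋ z → Part yb ∋ z → ⊥
        apart z c d = B-disjoint (via-weaken (part⇒avoidBoth xb z c)) (via-weaken (part⇒avoidBoth yb z d))

      θ-nested : θ E (⁅ ea ⁆ ∪ ⁅ eb ⁆) ≡ sortDesc (k ∷ (i ∸ k) ∷ (n ∸ i) ∷ [])
      θ-nested = trans (θ-three-parts yb xb xa cover yb∤xb yb∤xa xb∤xa)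
        (cong₂ (λ a b → sortDesc (a ∷ b)) size-yb (cong₂ (λ a b → a ∷ b ∷ []) size-xb size-xa))
        where
        cover : ∀ z → WalkVia AvoidBoth yb z ⊎ WalkVia AvoidBoth xb z ⊎ WalkVia AvoidBoth xa z
        cover z with two-sides eB z
        ... | inj₂ Bz = inj₁ (avoid-both (via-sym (B⊆A yb wnil) ⊙ B⊆A z Bz) Bz)
        ... | inj₁ xb→z with two-sides eA z
        ...   | inj₂ Az   = inj₂ (inj₁ (avoid-both (via-sym Axb ⊙ Az) xb→z))
        ...   | inj₁ xa→z = inj₂ (inj₂ (avoid-both xa→z (via-sym (not-B xa∉B) ⊙ xb→z)))
        yb∤xb : ¬ WalkVia AvoidBoth yb xb
        yb∤xb w = B-disjoint (via-sym (via-weaken w)) wnil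
        yb∤xa : ¬ WalkVia AvoidBoth yb xa
        yb∤xa w = A-disjoint wnil (B⊆A yb wnil ⊙ via-mono (λ _ → proj₁) w)
        xb∤xa : ¬ WalkVia AvoidBoth xb xa
        xb∤xa w = A-disjoint wnil (Axb ⊙ via-mono (λ _ → proj₁) w)

      k-pos : 1 ≤ k
      k-pos = subst (1 ≤_) size-yb (part-nonempty yb)

      i∸k-pos : 1 ≤ i ∸ k
      i∸k-pos = subst (1 ≤_) size-xb (part-nonempty xb)

      n∸i-pos : 1 ≤ n ∸ i
      n∸i-pos = subst (1 ≤_) size-xa (part-nonempty xa)

    module Disjoint (A∩B=∅ : ∀ z → A z → ¬ B z) where

      yb∉A : ¬ A yb
      yb∉A Ayb = A∩B=∅ yb Ayb wnil

      size-ya : ∣ Part ya ∣ ≡ i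
      size-ya = trans (card-cong (Part ya) (Side ea ya)
          (λ z c → avoid⇒side ea ya z (via-mono (λ _ → proj₁) (part⇒avoidBoth ya z c)))
          (λ z c → let Az = side⇒avoid ea ya z c in
                   avoidBoth⇒part ya z (avoid-both Az (via-sym (not-B (A∩B=∅ ya wnil)) ⊙ not-B (A∩B=∅ z Az)))))
        |ya|

      size-yb : ∣ Part yb ∣ ≡ k
      size-yb = trans (card-cong (Part yb) (Side eb yb)
          (λ z c → avoid⇒side eb yb z (via-weaken (part⇒avoidBoth yb z c)))
          (λ z c → let Bz = side⇒avoid eb yb z c in
                   avoidBoth⇒part yb z (avoid-both (via-sym (not-A yb∉A) ⊙ not-A (λ Az → A∩B=∅ z Az Bz)) Bz)))
        |yb|

      -- the big side of ea is the disjoint union of the parts of xa and yb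
      size-xa : ∣ Part xa ∣ ≡ (n ∸ i) ∸ k
      size-xa = trans (sym (ℕₚ.m+n∸n≡m ∣ Part xa ∣ k))
        (cong (_∸ k) (trans (cong (∣ Part xa ∣ +_) (sym size-yb))
          (trans (sym (card-disjoint-union (Part xa) (Part yb) (Side ea xa) split xa⊆ yb⊆ apart)) |xa|)))
        where
        split : ∀ z → Side ea xa ∋ z → Part xa ∋ z ⊎ Part yb ∋ z
        split z c with two-sides eB z
        ... | inj₂ Bz = inj₂ (avoidBoth⇒part yb z (avoid-both (via-sym (not-A yb∉A) ⊙ side⇒avoid ea xa z c) Bz))
        ... | inj₁ xb→z = inj₁ (avoidBoth⇒part xa z
                              (avoid-both (side⇒avoid ea xa z c) (via-sym (not-B xa∉B) ⊙ xb→z)))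
        xa⊆ : ∀ z → Part xa ∋ z → Side ea xa ∋ z
        xa⊆ z c = avoid⇒side ea xa z (via-mono (λ _ → proj₁) (part⇒avoidBoth xa z c))
        yb⊆ : ∀ z → Part yb ∋ z → Side ea xa ∋ z
        yb⊆ z c = avoid⇒side ea xa z (not-A yb∉A ⊙ via-mono (λ _ → proj₁) (part⇒avoidBoth yb z c))
        apart : ∀ z → Part xa ∋ z → Part yb ∋ z → ⊥
        apart z c d = B-disjoint (not-B xa∉B ⊙ via-weaken (part⇒avoidBoth xa z c))
                                 (via-weaken (part⇒avoidBoth yb z d))

      θ-disjoint : θ E (⁅ ea ⁆ ∪ ⁅ eb ⁆) ≡ sortDesc (i ∷ k ∷ ((n ∸ i) ∸ k) ∷ [])
      θ-disjoint = trans (θ-three-parts ya yb xa cover ya∤yb ya∤xa yb∤xa)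
        (cong₂ (λ a b → sortDesc (a ∷ b)) size-ya (cong₂ (λ a b → a ∷ b ∷ []) size-yb size-xa))
        where
        cover : ∀ z → WalkVia AvoidBoth ya z ⊎ WalkVia AvoidBoth yb z ⊎ WalkVia AvoidBoth xa z
        cover z with two-sides eA z
        ... | inj₂ Az = inj₁ (avoid-both Az (via-sym (not-B (A∩B=∅ ya wnil)) ⊙ not-B (A∩B=∅ z Az)))
        ... | inj₁ xa→z with two-sides eB z
        ...   | inj₂ Bz   = inj₂ (inj₁ (avoid-both (via-sym (not-A yb∉A) ⊙ xa→z) Bz))
        ...   | inj₁ xb→z = inj₂ (inj₂ (avoid-both xa→z (via-sym (not-B xa∉B) ⊙ xb→z)))
        ya∤yb : ¬ WalkVia AvoidBoth ya yb
        ya∤yb w = yb∉A (via-mono (λ _ → proj₁) w)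
        ya∤xa : ¬ WalkVia AvoidBoth ya xa
        ya∤xa w = A-disjoint wnil (via-mono (λ _ → proj₁) w)
        yb∤xa : ¬ WalkVia AvoidBoth yb xa
        yb∤xa w = xa∉B (via-weaken w)

      k-pos : 1 ≤ k
      k-pos = subst (1 ≤_) size-yb (part-nonempty yb)

      i-pos : 1 ≤ i
      i-pos = subst (1 ≤_) size-ya (part-nonempty ya)

      rest-pos : 1 ≤ (n ∸ i) ∸ k
      rest-pos = subst (1 ≤_) size-xa (part-nonempty xa)

module PathsInTree {n m : ℕ} (E : Edges n m) (tree : IsTree E) where

  open Tree E tree

  consec-∈ : ∀ {x y : Fin n} {l} → Consec x y l → x ∈ l × y ∈ l
  consec-∈ now       = here refl , there (here refl)
  consec-∈ (later q) = let (a , b) = consec-∈ q in there a , there b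

  consec-∷ʳ : ∀ {x y z : Fin n} {l} → Consec x y l → Consec x y (l ∷ʳ z)
  consec-∷ʳ now       = now
  consec-∷ʳ (later q) = later (consec-∷ʳ q)

  consec-reverse : ∀ {a b : Fin n} {l} → Consec a b l → Consec b a (reverse l)
  consec-reverse {a} {b} (now {xs = xs}) =
    subst (Consec b a) (sym (trans (Listₚ.unfold-reverse a (b ∷ xs)) (cong (_∷ʳ a) (Listₚ.unfold-reverse b xs))))
      (last-two (reverse xs))
    where
    last-two : ∀ ys → Consec b a ((ys ∷ʳ b) ∷ʳ a)
    last-two []       = now
    last-two (_ ∷ ys) = later (last-two ys)
  consec-reverse {a} {b} (later {x = x} {xs = l} q) =
    subst (Consec b a) (sym (Listₚ.unfold-reverse x l)) (consec-∷ʳ (consec-reverse q))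

  linked⇒pathVia : ∀ {x xs} → Linked (Adj (allEdges E)) (x ∷ xs) →
    Σ (Fin n) λ v → PathVia AnyEdge x v (x ∷ xs)
  linked⇒pathVia lk = let (v , p) = linked⇒path lk in v , path-map adj⇒step p

  path⇒isPath : ∀ {c t l} → PathVia AnyEdge c t l → Unique l → IsPath (allEdges E) l
  path⇒isPath pc un = un , path⇒linked (path-map step⇒adj pc)

  onPath⇒consec : ∀ {g l} → OnPath (lookup E g) l → Σ (Fin n) λ x → Σ (Fin n) λ y → Consec x y l × Joins g x y
  onPath⇒consec {g} (inj₁ q) = _ , _ , q , joins-ends g
  onPath⇒consec {g} (inj₂ q) = _ , _ , q , joins-sym (joins-ends g)

  separated⇒onPath : ∀ {g c t l} → PathVia AnyEdge c t l → ¬ WalkVia (Avoid g) c t → OnPath (lookup E g) l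
  separated⇒onPath pnil ns = ⊥-elim (ns wnil)
  separated⇒onPath {g} (pcons (j , _ , e) rest) ns with j ≟ᶠ g | path-head rest
  ... | yes refl | t , refl with joins-cases e
  ...   | inj₁ (refl , refl) = inj₁ now
  ...   | inj₂ (refl , refl) = inj₂ now
  separated⇒onPath {g} (pcons (j , _ , e) rest) ns | no j≢g | _
    with separated⇒onPath {g} rest (λ w → ns (edge-walk j≢g e ⊙ w))
  ... | inj₁ q = inj₁ (later q)
  ... | inj₂ q = inj₂ (later q)

  crossing : ∀ {g c v l x y} → PathVia AnyEdge c v l → Unique l → Consec x y l → Joins g x y →
    WalkVia (Avoid g) c x ×
    Σ (List (Fin n)) λ s → Suffix (y ∷ s) l × (∀ z → z ∈ y ∷ s → WalkVia (Avoid g) y z)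
  crossing {g} {c} (pcons {w = y} {l = l'} (j , _ , e') rest) un now e =
    wnil , _ , suffix-∷ suffix-refl , λ z z∈ → via-sym (beyond (here refl)) ⊙ beyond z∈
    where
    beyond : ∀ {z} → z ∈ l' → WalkVia (Avoid g) y z
    beyond z∈ = via-weaken (path-prefix (avoid-end e rest (unique-head un)) z∈)
  crossing {g} {c} {x = x} {y} (pcons {l = l'} (j , _ , e') rest) un (later q) e with j ≟ᶠ g
  ... | yes refl = ⊥-elim (unique-head un (repeated (joins-endpoint e e') (consec-∈ q)))
    where
    repeated : c ≡ x ⊎ c ≡ y → x ∈ l' × y ∈ l' → c ∈ l'
    repeated (inj₁ refl) (x∈ , _) = x∈
    repeated (inj₂ refl) (_ , y∈) = y∈
  ... | no j≢g with crossing rest (unique-tail un) q e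
  ...   | w→x , s , suf , after = edge-walk j≢g e' ⊙ w→x , s , suffix-∷ suf , after

  ∷ʳ-nonempty : ∀ (c : Fin n) ys → Σ (Fin n) λ a → Σ (List (Fin n)) λ b → ys ∷ʳ c ≡ a ∷ b
  ∷ʳ-nonempty c []       = c , [] , refl
  ∷ʳ-nonempty c (y ∷ ys) = y , ys ∷ʳ c , refl

  start-at : ∀ {c p} → IsPath (allEdges E) p → HasEndpoint c p →
    Σ (List (Fin n)) λ l → Σ (Fin n) λ v → PathVia AnyEdge c v l × Unique l ×
      (∀ {g} → OnPath (lookup E g) p → OnPath (lookup E g) l)
  start-at {c} (un , lk) (inj₁ (xs , refl)) = let (v , pc) = linked⇒pathVia lk in _ , v , pc , un , id
  start-at {c} (un , lk) (inj₂ (xs , refl)) with ∷ʳ-nonempty c xs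
  ... | x₀ , r , eq = l , x₀ , subst (λ q → PathVia AnyEdge q x₀ l) v≡c reversed , unique-reverse un , flip
    where
    l : List (Fin n)
    l = reverse (xs ∷ʳ c)
    forward : Σ (Fin n) λ v → PathVia AnyEdge x₀ v (x₀ ∷ r)
    forward = linked⇒pathVia (subst (Linked (Adj (allEdges E))) eq lk)
    reversed : PathVia AnyEdge (proj₁ forward) x₀ l
    reversed = subst (PathVia AnyEdge _ x₀) (cong reverse (sym eq)) (path-reverse step-sym (proj₂ forward))
    v≡c : proj₁ forward ≡ c
    v≡c = let (t , e₁) = path-head reversed in
          cong first-vertex (trans (sym e₁) (Listₚ.reverse-++ xs (c ∷ [])))
      where
      first-vertex : List (Fin n) → Fin n
      first-vertex []      = c
      first-vertex (a ∷ _) = a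
    flip : ∀ {g} → OnPath (lookup E g) (xs ∷ʳ c) → OnPath (lookup E g) l
    flip (inj₁ q) = inj₂ (consec-reverse q)
    flip (inj₂ q) = inj₁ (consec-reverse q)

re-positive : ∀ a b c → 1 ≤ a → 1 ≤ b → 1 ≤ c → re (a ∷ b ∷ c ∷ []) ≡ sortDesc (a ∷ b ∷ c ∷ [])
re-positive (suc a) (suc b) (suc c) _ _ _ = refl

reverse₃ : ∀ (a b c : ℕ) → (a ∷ b ∷ c ∷ []) ↭ (c ∷ b ∷ a ∷ [])
reverse₃ a b c = ↭-trans (↭-swap a b ↭-refl) (↭-trans (↭-prep b (↭-swap a c ↭-refl)) (↭-swap b c ↭-refl))

swap₂₃ : ∀ (a b c : ℕ) → (a ∷ b ∷ c ∷ []) ↭ (a ∷ c ∷ b ∷ [])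
swap₂₃ a b c = ↭-prep a (↭-swap b c ↭-refl)

-- With N ∸ i ≠ i and i, k ≥ 1, no arrangement of i, k, r equals re(N ∸ i, i ∸ k, k):
-- i would have to be the entry k, and then re(N ∸ i, 0, k) has at most two parts.
disjoint-partition-mismatch : ∀ N i k r → N ∸ i ≢ i → 1 ≤ i → 1 ≤ k →
  sortDesc (i ∷ k ∷ r ∷ []) ≢ re ((N ∸ i) ∷ (i ∸ k) ∷ k ∷ [])
disjoint-partition-mismatch N i k r N∸i≢i 1≤i 1≤k eq
  with ∈ₚ.∈-filter⁻ (T? ∘ (λ x → 0 <ᵇ x)) {xs = (N ∸ i) ∷ (i ∸ k) ∷ k ∷ []}
         (↭ₚ.∈-resp-↭ (sortDesc-↭ _) (subst (i ∈_) eq (↭ₚ.∈-resp-↭ (↭-sym (sortDesc-↭ (i ∷ k ∷ r ∷ []))) (here refl))))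
... | here e , _ = N∸i≢i (sym e)
... | there (here e) , _ = i≢i∸k i k 1≤i 1≤k e
  where
  i≢i∸k : ∀ i k → 1 ≤ i → 1 ≤ k → i ≢ i ∸ k
  i≢i∸k (suc i) (suc k) _ _ e = ℕₚ.<-irrefl refl (subst (_≤ i) (sym e) (ℕₚ.m∸n≤m i k))
... | there (there (here refl)) , _ =
  ℕₚ.<-irrefl refl (ℕₚ.≤-trans (ℕₚ.≤-reflexive three≡parts) (subst (λ d → length (positive ((N ∸ i) ∷ d ∷ i ∷ [])) ≤ 2)
    (sym (ℕₚ.n∸n≡0 i)) (at-most-two (N ∸ i) i)))
  where
  positive : List ℕ → List ℕ
  positive = filterᵇ (λ x → 0 <ᵇ x)
  three≡parts : 3 ≡ length (positive ((N ∸ i) ∷ (i ∸ i) ∷ i ∷ []))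
  three≡parts = trans (sym (↭ₚ.↭-length (sortDesc-↭ (i ∷ i ∷ r ∷ []))))
    (trans (cong length eq) (↭ₚ.↭-length (sortDesc-↭ (positive ((N ∸ i) ∷ (i ∸ i) ∷ i ∷ [])))))
  at-most-two : ∀ a c → length (positive (a ∷ 0 ∷ c ∷ [])) ≤ 2
  at-most-two zero    zero    = z≤n
  at-most-two zero    (suc c) = s≤s z≤n
  at-most-two (suc a) zero    = s≤s z≤n
  at-most-two (suc a) (suc c) = s≤s (s≤s z≤n)

-- A centroid lies on the big side of
-- every edge; when ea is unbalanced it lies outside both small sides A and B,
-- so a path from it can only meet both edges when B ⊆ A.

module Attraction {n m : ℕ} (E : Edges n m) (tree : IsTree E) (ea eb : Fin m) (ea≢eb : ea ≢ eb)
  (i k : ℕ) (k≤i : k ≤ i)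
  (θa : θ E ⁅ ea ⁆ ≡ (n ∸ i) ∷ i ∷ []) (θb : θ E ⁅ eb ⁆ ≡ (n ∸ k) ∷ k ∷ []) where

  open Tree E tree
  open Centroids E tree ea
  open PathsInTree E tree
  open TwoEdges E tree ea eb
  open Configuration ea≢eb i k k≤i θa θb public

  Θ : List ℕ
  Θ = re ((n ∸ i) ∷ (i ∸ k) ∷ k ∷ [])

  attract-via : ∀ c t → Centroid E c → ¬ WalkVia (Avoid ea) c t → ¬ WalkVia (Avoid eb) c t → Attract E ea eb
  attract-via c t centroid ¬a ¬b with path-between c t
  ... | l , pc , un = c , centroid , l , path⇒isPath pc un , inj₁ (path-head pc)
                    , separated⇒onPath pc ¬a , separated⇒onPath pc ¬b

  centroid∉A : ∀ c → Centroid E c → n ∸ i ≢ i → ¬ A c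
  centroid∉A c centroid unbalanced Ac = unbalanced (ℕₚ.≤-antisym
    (subst₂ _≤_ |xa| |ya| (centroid-side centroid (joins-sym eA) Ac)) i≤n∸i)

  centroid∉B : ∀ c → Centroid E c → n ∸ i ≢ i → ¬ B c
  centroid∉B c centroid unbalanced Bc = unbalanced (ℕₚ.≤-antisym
    (ℕₚ.≤-trans (ℕₚ.∸-monoʳ-≤ n k≤i)
      (ℕₚ.≤-trans (subst₂ _≤_ |xb| |yb| (centroid-side centroid (joins-sym eB) Bc)) k≤i)) i≤n∸i)

  module _ (B⊆A : ∀ z → B z → A z) (Axb : A xb) where
    open Nested B⊆A Axb

    -- yb is separated from xa by ea and by eb; if ea is balanced xa is a centroid,
    -- otherwise every centroid lies with xa outside A
    nested-attract : Attract E ea eb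
    nested-attract with (n ∸ i) ≟ℕ i
    ... | yes balanced = attract-via xa yb (balanced⇒centroid eA (trans |xa| (trans balanced (sym |ya|))))
                           (λ w → A-disjoint w (B⊆A yb wnil)) (λ w → xa∉B (via-sym w))
    ... | no unbalanced = let (c , centroid) = centroid-exists in
      attract-via c yb centroid
        (λ w → centroid∉A c centroid unbalanced (B⊆A yb wnil ⊙ via-sym w))
        (λ w → centroid∉B c centroid unbalanced (via-sym w))

    nested-θ : θ E (⁅ ea ⁆ ∪ ⁅ eb ⁆) ≡ Θ
    nested-θ = trans θ-nested (trans (sortDesc-cong (reverse₃ k (i ∸ k) (n ∸ i)))
      (sym (re-positive _ _ _ n∸i-pos i∸k-pos k-pos)))

  module _ (A∩B=∅ : ∀ z → A z → ¬ B z) where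
    open Disjoint A∩B=∅

    -- balanced ea: its small end ya is a centroid, separated from yb by both edges
    balanced-attract : n ∸ i ≡ i → Attract E ea eb
    balanced-attract balanced =
      attract-via ya yb (balanced⇒centroid (joins-sym eA) (trans |ya| (sym (trans |xa| balanced))))
        yb∉A (λ w → A∩B=∅ ya wnil (via-sym w))

    balanced-θ : n ∸ i ≡ i → θ E (⁅ ea ⁆ ∪ ⁅ eb ⁆) ≡ Θ
    balanced-θ balanced = begin
      θ E (⁅ ea ⁆ ∪ ⁅ eb ⁆)                 ≡⟨ θ-disjoint ⟩
      sortDesc (i ∷ k ∷ ((n ∸ i) ∸ k) ∷ []) ≡⟨ cong (λ d → sortDesc (i ∷ k ∷ d ∷ [])) rest≡ ⟩
      sortDesc (i ∷ k ∷ (i ∸ k) ∷ [])       ≡⟨ sortDesc-cong (swap₂₃ i k (i ∸ k)) ⟩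
      sortDesc (i ∷ (i ∸ k) ∷ k ∷ [])       ≡⟨ cong (λ d → sortDesc (d ∷ (i ∸ k) ∷ k ∷ [])) (sym balanced) ⟩
      sortDesc ((n ∸ i) ∷ (i ∸ k) ∷ k ∷ []) ≡⟨ sym (re-positive _ _ _ (subst (1 ≤_) (sym balanced) i-pos)
                                                   (subst (1 ≤_) rest≡ rest-pos) k-pos) ⟩
      Θ                                     ∎
      where
      open Relation.Binary.PropositionalEquality.≡-Reasoning
      rest≡ : (n ∸ i) ∸ k ≡ i ∸ k
      rest≡ = cong (_∸ k) balanced

    unbalanced-θ : n ∸ i ≢ i → θ E (⁅ ea ⁆ ∪ ⁅ eb ⁆) ≢ Θ
    unbalanced-θ unbalanced eq =
      disjoint-partition-mismatch n i k ((n ∸ i) ∸ k) unbalanced i-pos k-pos (trans (sym θ-disjoint) eq)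

    -- A path from a centroid c ∉ A ∪ B through ea and eb: after crossing ea it
    -- stays in A, after crossing eb it stays in B, and one of these two tails of
    -- the path contains the other, which would meet A ∩ B.
    unbalanced-repel : n ∸ i ≢ i → ¬ Attract E ea eb
    unbalanced-repel unbalanced (c , centroid , p , is-path , endpoint , on-a , on-b)
      with start-at is-path endpoint
    ... | l , v , pc , un , reorient
      with onPath⇒consec (reorient on-a) | onPath⇒consec (reorient on-b)
    ... | x , y , q , e | x' , y' , q' , e'
      with crossing pc un q e | crossing pc un q' e'
    ... | c→x , s , suf , after | c→x' , s' , suf' , after' = meet (suffix-comparable suf suf')
      where
      Ay : A y
      Ay with two-sides eA y
      ... | inj₂ Ay = Ay
      ... | inj₁ xa→y = ⊥-elim (cut-separates e (via-sym c→x ⊙ via-sym (not-A (centroid∉A c centroid unbalanced)) ⊙ xa→y))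
      By' : B y'
      By' with two-sides eB y'
      ... | inj₂ By' = By'
      ... | inj₁ xb→y' = ⊥-elim (cut-separates e' (via-sym c→x' ⊙ via-sym (not-B (centroid∉B c centroid unbalanced)) ⊙ xb→y'))
      in-A : ∀ z → z ∈ y ∷ s → A z
      in-A z z∈ = Ay ⊙ after z z∈
      in-B : ∀ z → z ∈ y' ∷ s' → B z
      in-B z z∈ = By' ⊙ after' z z∈
      meet : Suffix (y ∷ s) (y' ∷ s') ⊎ Suffix (y' ∷ s') (y ∷ s) → ⊥
      meet (inj₁ sf) = A∩B=∅ y (in-A y (here refl)) (in-B y (suffix-head sf))
      meet (inj₂ sf) = A∩B=∅ y' (in-A y' (suffix-head sf)) (in-B y' (here refl))

proposition5p4 : (n m : ℕ) (E : Edges n m) → IsTree E →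
    (ea eb : Fin m) → ea ≢ eb → (i k : ℕ) → k ≤ i →
    θ E ⁅ ea ⁆ ≡ (n ∸ i) ∷ i ∷ [] →
    θ E ⁅ eb ⁆ ≡ (n ∸ k) ∷ k ∷ [] →
    (θ E (⁅ ea ⁆ ∪ ⁅ eb ⁆) ≡ re ((n ∸ i) ∷ (i ∸ k) ∷ k ∷ []) ⇔ Attract E ea eb)
proposition5p4 n m E tree ea eb ea≢eb i k k≤i θa θb = by-cases configuration ((n ∸ i) ≟ℕ i)
  where
  open Attraction E tree ea eb ea≢eb i k k≤i θa θb
  by-cases : Configuration → Dec (n ∸ i ≡ i) → (θ E (⁅ ea ⁆ ∪ ⁅ eb ⁆) ≡ Θ) ⇔ Attract E ea eb
  by-cases (nested B⊆A Axb) _ =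
    mk⇔ (λ _ → nested-attract B⊆A Axb) (λ _ → nested-θ B⊆A Axb)
  by-cases (disjoint A∩B=∅) (yes balanced) =
    mk⇔ (λ _ → balanced-attract A∩B=∅ balanced) (λ _ → balanced-θ A∩B=∅ balanced)
  by-cases (disjoint A∩B=∅) (no unbalanced) =
    mk⇔ (λ eq → ⊥-elim (unbalanced-θ A∩B=∅ unbalanced eq)) (λ at → ⊥-elim (unbalanced-repel A∩B=∅ unbalanced at))
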